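{- Let $\mathbb F$ be a finite field with $q^r$ elements ($q$ a prime power, $r>1$), $\tau$ a primitive element of $\mathbb F$, $\theta=\tau^{q-1}$, and $t=(q^r-1)/(q-1)$. Let $N=\{\begin{pmatrix}1&0\\ \alpha&1\end{pmatrix}:\alpha\in\mathbb F\}$, $\psi^{+}:N\to\mathbb F$ the isomorphism onto $(\mathbb F,+)$ sending $\begin{pmatrix}1&0\\ \alpha&1\end{pmatrix}$ to $\alpha$, $f=\begin{pmatrix}1&0\\ 0&\theta\end{pmatrix}$, and $G=N\langle f\rangle$ (a group of order $q^r(q^r-1)/(q-1)$). Let $M\le N$ be such that $\psi^+(M)$ is an $(r-1)$-dimensional $\mathbb F_q$-subspace of $\mathbb F$, and for each integer $i$ let $M_i\le N$ be defined by $\psi^+(M_i)=\psi^+(M)\tau^i$ (indices read modulo $t$). Let $\varphi$ be a permutation of $\{1,\dots,t\}$ (arguments read modulo $t$), let $$S=\bigcup_{i=1}^{t} f^i\,(N\setminus M_{\varphi(i)}),$$ and suppose that $\psi^{+}(M_{\varphi(i)})\,\theta^{i}=\psi^{+}(M_{\varphi(t-i)})$ for every integer $i$. Then the Cayley graph $\Gamma=\mathrm{Cay}(G,S)$ is a divisible design graph with parameters $(v,k,\lambda_1,\lambda_2,m,n)$, where $$v=\frac{q^r(q^r-1)}{q-1},\quad k=q^{r-1}(q^r-1),\quad \lambda_1=q^{r-1}(q^r-q^{r-1}-1),$$ $$\lambda_2=q^{r-2}(q-1)(q^r-1),\quad m=\frac{q^r-1}{q-1},\quad n=q^r.$$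
   Context: $\mathbb F$ is regarded as an $r$-dimensional vector space over its subfield $\mathbb F_q$; $f^i(N\setminus M_j)=\{f^ia: a\in N\setminus M_j\}$; $f$ has order $t$, so exponents of $f$ are read modulo $t$. For a finite group $G$ with identity $e$ and $S\subseteq G$ closed under inversion with $e\notin S$, $\mathrm{Cay}(G,S)$ has vertex set $G$, with $x,y$ adjacent iff $xy^{ -1}\in S$. A $k$-regular graph on $v$ vertices is a divisible design graph with parameters $(v,k,\lambda_1,\lambda_2,m,n)$ if its vertex set can be partitioned into $m$ classes of size $n$ such that any two distinct vertices in the same class have exactly $\lambda_1$ common neighbors and any two vertices in different classes have exactly $\lambda_2$ common neighbors. -}

module Defs where

open import Data.Nat as ℕ using (ℕ; zero; suc; _≤_)
open import Data.Nat.Primality using (Prime)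
open import Data.Fin using (Fin; zero; suc; toℕ; opposite)
open import Data.Fin.Permutation using (Permutation′; _⟨$⟩ʳ_)
open import Data.List using (List; length)
open import Data.List.Membership.Propositional using (_∈_)
open import Data.List.Relation.Unary.Unique.Propositional using (Unique)
open import Data.Vec using (Vec; []; _∷_)
open import Data.Vec.Relation.Unary.All using (All)
open import Data.Product using (Σ; _×_; _,_)
open import Data.Unit using (⊤)
open import Function.Bundles using (_⇔_)
open import Relation.Binary.PropositionalEquality using (_≡_; _≢_)
open import Relation.Nullary using (¬_)
open import Algebra.Structures using (IsCommutativeRing)

HasSize : {X : Set} → (X → Set) → ℕ → Set
HasSize {X} P n =
  Σ (List X) λ L → Unique L × (∀ z → (P z ⇔ (z ∈ L))) × length L ≡ n

IsDDG : {X : Set} → (V : X → Set) → (Adj : X → X → Set) →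
        (v k λ₁ λ₂ m n : ℕ) → Set
IsDDG {X} V Adj v k λ₁ λ₂ m n =
  HasSize V v ×
  (∀ x → V x → HasSize (λ z → V z × Adj x z) k) ×
  Σ (X → Fin m) λ cls →
    (∀ c → HasSize (λ z → V z × cls z ≡ c) n) ×
    (∀ x y → V x → V y → x ≢ y → cls x ≡ cls y →
       HasSize (λ z → V z × Adj x z × Adj y z) λ₁) ×
    (∀ x y → V x → V y → cls x ≢ cls y →
       HasSize (λ z → V z × Adj x z × Adj y z) λ₂)

record Field : Set₁ where
  infixl 6 _+_
  infixl 7 _*_
  infix  8 -_
  infixr 9 _^ᶠ_
  field
    Carrier : Set
    _+_ _*_ : Carrier → Carrier → Carrier
    -_      : Carrier → Carrier
    0# 1#   : Carrier
    _⁻¹     : Carrier → Carrier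
    isCommutativeRing : IsCommutativeRing _≡_ _+_ _*_ -_ 0# 1#
    0≢1        : 0# ≢ 1#
    ⁻¹-inverse : ∀ x → x ≢ 0# → x * (x ⁻¹) ≡ 1#

  _^ᶠ_ : Carrier → ℕ → Carrier
  x ^ᶠ zero  = 1#
  x ^ᶠ suc n = x * (x ^ᶠ n)

IsPrimePower : ℕ → Set
IsPrimePower q = Σ ℕ λ p → Σ ℕ λ e → Prime p × 1 ≤ e × q ≡ p ℕ.^ e

-- additive inverse modulo t on residues Fin t (i ↦ t - i mod t)
negF : ∀ {t} → Fin t → Fin t
negF {suc n} zero    = zero
negF {suc n} (suc k) = suc (opposite k)

module FieldTheory (𝔽 : Field) where
  open Field 𝔽 public

  F : Set
  F = Carrier

  IsSubfield : (F → Set) → Set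
  IsSubfield K =
    K 0# × K 1# ×
    (∀ x y → K x → K y → K (x + y)) ×
    (∀ x y → K x → K y → K (x * y)) ×
    (∀ x → K x → K (- x)) ×
    (∀ x → K x → x ≢ 0# → K (x ⁻¹))

  IsPrimitive : F → Set
  IsPrimitive τ = ∀ x → x ≢ 0# → Σ ℕ λ j → x ≡ τ ^ᶠ j

  IsSubspace : (F → Set) → (F → Set) → Set
  IsSubspace K W =
    W 0# ×
    (∀ x y → W x → W y → W (x + y)) ×
    (∀ c w → K c → W w → W (c * w))

  lincomb : ∀ {d} → Vec F d → Vec F d → F
  lincomb []       []       = 0#
  lincomb (c ∷ cs) (b ∷ bs) = c * b + lincomb cs bs

  HasDim : (F → Set) → (F → Set) → ℕ → Set
  HasDim K W d =
    Σ (Vec F d) λ b →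
      All W b ×
      (∀ w → W w → Σ (Vec F d) λ c → All K c × w ≡ lincomb c b) ×
      (∀ c → All K c → lincomb c b ≡ 0# → All (λ x → x ≡ 0#) c)

  record Mat2 : Set where
    constructor mat
    field
      a₁₁ a₁₂ a₂₁ a₂₂ : F

  infixl 7 _·_
  _·_ : Mat2 → Mat2 → Mat2
  mat a b c d · mat a' b' c' d' =
    mat (a * a' + b * c') (a * b' + b * d')
        (c * a' + d * c') (c * b' + d * d')

  I₂ : Mat2
  I₂ = mat 1# 0# 0# 1#

  det : Mat2 → F
  det (mat a b c d) = a * d + - (b * c)

  inv : Mat2 → Mat2
  inv (mat a b c d) =
    let δ = det (mat a b c d) ⁻¹ in
    mat (δ * d) (δ * (- b)) (δ * (- c)) (δ * a)

  mpow : Mat2 → ℕ → Mat2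
  mpow A zero    = I₂
  mpow A (suc n) = A · mpow A n

  -- elements of N :  ( 1 0 ; α 1 ),  ψ⁺ of it is α
  nmat : F → Mat2
  nmat α = mat 1# 0# α 1#

  fmat : F → Mat2
  fmat θ = mat 1# 0# 0# θ

  InG : F → Mat2 → Set
  InG θ A = Σ F λ α → Σ ℕ λ j → A ≡ nmat α · mpow (fmat θ) j

  -- ψ⁺(M_i) = ψ⁺(M) τ^i , where W = ψ⁺(M)
  ψM : (F → Set) → F → ℕ → F → Set
  ψM W τ i α = Σ F λ w → W w × α ≡ w * (τ ^ᶠ i)

  -- S = ⋃_{i mod t} f^i (N ∖ M_{φ(i)}) ; residues mod t as Fin t
  InS : ∀ {t} → (F → Set) → (τ θ : F) → Permutation′ t → Mat2 → Set
  InS {t} W τ θ φ A =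
    Σ (Fin t) λ i → Σ F λ α →
      ¬ ψM W τ (toℕ (φ ⟨$⟩ʳ i)) α × A ≡ mpow (fmat θ) (toℕ i) · nmat α

  CayAdj : ∀ {t} → (F → Set) → (τ θ : F) → Permutation′ t → Mat2 → Mat2 → Set
  CayAdj W τ θ φ x y = InS W τ θ φ (x · inv y)

module Submission where

-- A vertex ( 1 0 ; c θʲ ) of G is the pair (c , j) ∈ F × ℤ_t, its class being j, and (c , j) is
-- adjacent to (a , u) exactly when c avoids the coset θ^{-(u-j)} a + M_{φ(u-j)}.  So degrees and
-- common neighbourhoods are counted class by class, by inclusion–exclusion over cosets of the
-- hyperplanes M_k, which have q^{r-1} elements:
--  * two distinct hyperplanes meet in q^{r-2} points in every pair of their cosets, which gives λ₂;
--  * for a ≠ b in the same class the two cosets in class j coincide or are disjoint according as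
--    a - b ∈ M_{φ(-(u-j))} (the symmetry hypothesis), and a nonzero vector lies in exactly c of the
--    M_k, where 1 + (q-1) c = q^{r-1}; this gives λ₁.
-- The M_k (k < t) are pairwise distinct because a field element mapping W into itself is a
-- (q-1)-th root of unity.

open import Defs
open import Algebra.Bundles using (CommutativeRing)
open import Data.Nat as ℕ using (ℕ; _<_; _∸_; _^_)
open import Data.Fin using (Fin; toℕ)
open import Data.Fin.Permutation using (Permutation′; _⟨$⟩ʳ_)
open import Data.Product using (Σ; _×_)
open import Data.Unit using (⊤)
open import Function.Bundles using (_⇔_)
open import Relation.Binary.PropositionalEquality using (_≡_)
open import Relation.Nullary using (¬_)

-- Integer coefficients are represented as differences a − b of naturals, so
-- that coefficient equality is decidable in any commutative ring.
module IntegerCoefficientSolver {c ℓ} (R : CommutativeRing c ℓ) where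
  open import Algebra.Bundles using (RawRing)
  open import Data.Maybe using (Maybe; just; nothing)
  open import Data.Product using (_,_)
  import Relation.Binary.PropositionalEquality as ≡
  open import Relation.Nullary using (yes; no)
  import Algebra.Solver.Ring
  import Algebra.Solver.Ring.NaturalCoefficients.Default
  open import Algebra.Solver.Ring.AlmostCommutativeRing
    using (fromCommutativeRing; _-Raw-AlmostCommutative⟶_)

  open CommutativeRing R hiding (_-_)
  open import Algebra.Properties.Ring ring using (-‿involutive; -‿distribˡ-*; -‿distribʳ-*; -0#≈0#; -‿+-comm)
  open import Algebra.Properties.Semiring.Mult semiring using (×-homo-+; ×1-homo-*) renaming (_×_ to _×ₙ_)
  open import Relation.Binary.Reasoning.Setoid setoid
  module +-* = Algebra.Solver.Ring.NaturalCoefficients.Default commutativeSemiring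

  ℕ²-rawRing : RawRing _ _
  ℕ²-rawRing = record
    { Carrier = ℕ × ℕ ; _≈_ = _≡_
    ; _+_ = λ (a , b) (c , d) → a ℕ.+ c , b ℕ.+ d
    ; _*_ = λ (a , b) (c , d) → a ℕ.* c ℕ.+ b ℕ.* d , a ℕ.* d ℕ.+ b ℕ.* c
    ; -_ = λ (a , b) → b , a ; 0# = 0 , 0 ; 1# = 1 , 0 }

  ⟦_⟧ : ℕ × ℕ → Carrier
  ⟦ a , b ⟧ = a ×ₙ 1# + - (b ×ₙ 1#)

  private
    -‿+ : ∀ x y → - (x + y) ≈ - x + - y
    -‿+ x y = sym (-‿+-comm x y)

    +-homo : ∀ x y → ⟦ RawRing._+_ ℕ²-rawRing x y ⟧ ≈ ⟦ x ⟧ + ⟦ y ⟧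
    +-homo (a , b) (c , d) = begin
      (a ℕ.+ c) ×ₙ 1# + - ((b ℕ.+ d) ×ₙ 1#) ≈⟨ +-cong (×-homo-+ 1# a c) (-‿cong (×-homo-+ 1# b d)) ⟩
      (A + C) + - (B + D)                   ≈⟨ +-congˡ (-‿+ B D) ⟩
      (A + C) + (- B + - D)                 ≈⟨ +-*.solve 4 (λ A C B D → (A +-*.:+ C) +-*.:+ (B +-*.:+ D) +-*.:= (A +-*.:+ B) +-*.:+ (C +-*.:+ D)) refl A C (- B) (- D) ⟩
      (A + - B) + (C + - D)                 ∎
      where A = a ×ₙ 1#; B = b ×ₙ 1#; C = c ×ₙ 1#; D = d ×ₙ 1#

    *-homo : ∀ x y → ⟦ RawRing._*_ ℕ²-rawRing x y ⟧ ≈ ⟦ x ⟧ * ⟦ y ⟧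
    *-homo (a , b) (c , d) = begin
      (a ℕ.* c ℕ.+ b ℕ.* d) ×ₙ 1# + - ((a ℕ.* d ℕ.+ b ℕ.* c) ×ₙ 1#)
        ≈⟨ +-cong (homo₂ a c b d) (-‿cong (homo₂ a d b c)) ⟩
      (A * C + B * D) + - (A * D + B * C)     ≈⟨ +-congˡ (-‿+ _ _) ⟩
      (A * C + B * D) + (- (A * D) + - (B * C))
        ≈⟨ +-cong (+-congˡ (sym -B*-D)) (+-cong (-‿distribʳ-* A D) (-‿distribˡ-* B C)) ⟩
      (A * C + - B * - D) + (A * - D + - B * C)
        ≈⟨ +-*.solve 4 (λ A C B D → (A +-*.:* C +-*.:+ B +-*.:* D) +-*.:+ (A +-*.:* D +-*.:+ B +-*.:* C) +-*.:= (A +-*.:+ B) +-*.:* (C +-*.:+ D)) refl A C (- B) (- D) ⟩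
      (A + - B) * (C + - D)                   ∎
      where
      A = a ×ₙ 1#; B = b ×ₙ 1#; C = c ×ₙ 1#; D = d ×ₙ 1#
      homo₂ : ∀ a c b d → (a ℕ.* c ℕ.+ b ℕ.* d) ×ₙ 1# ≈ (a ×ₙ 1#) * (c ×ₙ 1#) + (b ×ₙ 1#) * (d ×ₙ 1#)
      homo₂ a c b d = trans (×-homo-+ 1# (a ℕ.* c) (b ℕ.* d)) (+-cong (×1-homo-* a c) (×1-homo-* b d))
      -B*-D : - B * - D ≈ B * D
      -B*-D = begin
        - B * - D    ≈⟨ sym (-‿distribˡ-* B (- D)) ⟩
        - (B * - D)  ≈⟨ -‿cong (sym (-‿distribʳ-* B D)) ⟩
        - - (B * D)  ≈⟨ -‿involutive _ ⟩
        B * D        ∎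

    -‿homo : ∀ x → ⟦ RawRing.-_ ℕ²-rawRing x ⟧ ≈ - ⟦ x ⟧
    -‿homo (a , b) = sym (begin
      - (A + - B)   ≈⟨ -‿+ A (- B) ⟩
      - A + - - B   ≈⟨ +-congˡ (-‿involutive B) ⟩
      - A + B       ≈⟨ +-comm _ _ ⟩
      B + - A       ∎)
      where A = a ×ₙ 1#; B = b ×ₙ 1#

    0-homo : ⟦ 0 , 0 ⟧ ≈ 0#
    0-homo = trans (+-congˡ -0#≈0#) (+-identityʳ 0#)

    1-homo : ⟦ 1 , 0 ⟧ ≈ 1#
    1-homo = trans (+-cong (+-identityʳ 1#) -0#≈0#) (+-identityʳ 1#)

    homomorphism : ℕ²-rawRing -Raw-AlmostCommutative⟶ fromCommutativeRing R
    homomorphism = record { ⟦_⟧ = ⟦_⟧ ; +-homo = +-homo ; *-homo = *-homo ; -‿homo = -‿homo ; 0-homo = 0-homo ; 1-homo = 1-homo }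

    ⟦⟧-cong : ∀ a b c d → a ℕ.+ d ≡ c ℕ.+ b → ⟦ a , b ⟧ ≈ ⟦ c , d ⟧
    ⟦⟧-cong a b c d a+d≡c+b = begin
      A + - B                 ≈⟨ +-congʳ (sym (trans (+-congˡ (-‿inverseʳ D)) (+-identityʳ A))) ⟩
      (A + (D + - D)) + - B   ≈⟨ +-*.solve 4 (λ A D -D -B → (A +-*.:+ (D +-*.:+ -D)) +-*.:+ -B +-*.:= (A +-*.:+ D) +-*.:+ (-D +-*.:+ -B)) refl A D (- D) (- B) ⟩
      (A + D) + (- D + - B)   ≈⟨ +-congʳ (trans (sym (×-homo-+ 1# a d)) (trans (reflexive (≡.cong (_×ₙ 1#) a+d≡c+b)) (×-homo-+ 1# c b))) ⟩
      (C + B) + (- D + - B)   ≈⟨ +-*.solve 4 (λ C B -D -B → (C +-*.:+ B) +-*.:+ (-D +-*.:+ -B) +-*.:= (C +-*.:+ -D) +-*.:+ (B +-*.:+ -B)) refl C B (- D) (- B) ⟩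
      (C + - D) + (B + - B)   ≈⟨ trans (+-congˡ (-‿inverseʳ B)) (+-identityʳ _) ⟩
      C + - D                 ∎
      where A = a ×ₙ 1#; B = b ×ₙ 1#; C = c ×ₙ 1#; D = d ×ₙ 1#

    coefficient-test : ∀ x y → Maybe (⟦ x ⟧ ≈ ⟦ y ⟧)
    coefficient-test (a , b) (c , d) with a ℕ.+ d ℕ.≟ c ℕ.+ b
    ... | yes a+d≡c+b = just (⟦⟧-cong a b c d a+d≡c+b)
    ... | no _        = nothing

  open Algebra.Solver.Ring ℕ²-rawRing (fromCommutativeRing R) homomorphism coefficient-test public
    using (solve; _:=_; _:+_; _:*_; :-_; _:-_)

module FiniteSets where
  open import Data.Nat as ℕ using (ℕ; zero; suc; _+_; _*_; _≤_; _<_; z≤n; s≤s)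
  import Data.Nat.Properties as ℕP
  open import Data.Fin as Fin using (Fin)
  import Data.Fin.Properties as FinP
  open import Data.List using (List; []; _∷_; length; map; filter; _++_; cartesianProduct; allFin; lookup)
  open import Data.List.Properties using (length-map; length-++; length-tabulate)
  open import Data.List.Membership.Propositional using (_∈_)
  open import Data.List.Membership.Propositional.Properties
    using (∈-∃++; ∈-++⁻; ∈-++⁺ˡ; ∈-++⁺ʳ; ∈-map⁺; ∈-map⁻; ∈-filter⁺; ∈-filter⁻; ∈-cartesianProduct⁺; ∈-cartesianProduct⁻; ∈-allFin)
  open import Data.List.Membership.DecPropositional using () renaming (_∈?_ to ∈?-with)
  open import Data.List.Relation.Unary.Unique.Propositional using (Unique)
  open import Data.List.Relation.Unary.Unique.Propositional.Properties
    using (filter⁺; cartesianProduct⁺; ++⁺; allFin⁺)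
  open import Data.List.Relation.Unary.AllPairs using ([]; _∷_)
  open import Data.List.Relation.Unary.All as All using (All; []; _∷_)
  open import Data.List.Relation.Unary.Any using (here; there; index)
  open import Data.List.Relation.Unary.Any.Properties using (lookup-index)
  open import Data.Product using (Σ; _×_; _,_; proj₁; proj₂)
  open import Data.Sum using (_⊎_; inj₁; inj₂)
  open import Data.Empty using (⊥-elim)
  open import Data.Unit using (⊤; tt)
  open import Function.Bundles using (_⇔_; mk⇔; Equivalence; _↣_; mk↣)
  open import Relation.Binary.PropositionalEquality
  open import Relation.Binary.Definitions using (DecidableEquality)
  open import Relation.Nullary using (¬_; Dec; yes; no; ¬?; decidable-stable)
  open import Data.Nat.Solver using (module +-*-Solver)

  private
    variable
      X Y : Set

    to : ∀ {A B : Set} → A ⇔ B → A → B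
    to = Equivalence.to
    from : ∀ {A B : Set} → A ⇔ B → B → A
    from = Equivalence.from

  length-cartesianProduct : (xs : List X) (ys : List Y) → length (cartesianProduct xs ys) ≡ length xs * length ys
  length-cartesianProduct [] ys = refl
  length-cartesianProduct (x ∷ xs) ys =
    trans (length-++ (map (x ,_) ys)) (cong₂ _+_ (length-map _ ys) (length-cartesianProduct xs ys))

  -- Opaque, so that counts (list lengths) are never unfolded during unification.
  opaque
    unique-⊆⇒length-≤ : {xs ys : List X} → Unique xs → (∀ {z} → z ∈ xs → z ∈ ys) → length xs ≤ length ys
    unique-⊆⇒length-≤ {xs = []} _ _ = z≤n
    unique-⊆⇒length-≤ {xs = x ∷ xs} {ys} (x∉xs ∷ unique) xs⊆ys with ∈-∃++ (xs⊆ys (here refl))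
    ... | as , bs , refl = subst (suc (length xs) ≤_) (sym (trans (length-++ as) (ℕP.+-suc (length as) (length bs))))
        (s≤s (subst (length xs ≤_) (length-++ as) (unique-⊆⇒length-≤ unique xs⊆as++bs)))
      where
      xs⊆as++bs : ∀ {z} → z ∈ xs → z ∈ as ++ bs
      xs⊆as++bs z∈xs with ∈-++⁻ as (xs⊆ys (there z∈xs))
      ... | inj₁ z∈as          = ∈-++⁺ˡ z∈as
      ... | inj₂ (here refl)   = ⊥-elim (All.lookup x∉xs z∈xs refl)
      ... | inj₂ (there z∈bs)  = ∈-++⁺ʳ as z∈bs

    size-≤ : {P Q : X → Set} {a b : ℕ} → (∀ x → P x → Q x) → HasSize P a → HasSize Q b → a ≤ b
    size-≤ P⊆Q (L , uL , mL , refl) (M , _ , mM , refl) =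
      unique-⊆⇒length-≤ uL (λ {z} z∈L → to (mM z) (P⊆Q z (from (mL z) z∈L)))

    size-unique : {P : X → Set} {m n : ℕ} → HasSize P m → HasSize P n → m ≡ n
    size-unique sm sn = ℕP.≤-antisym (size-≤ (λ _ p → p) sm sn) (size-≤ (λ _ p → p) sn sm)

    size-cong : {P Q : X → Set} {n : ℕ} → (∀ x → P x → Q x) → (∀ x → Q x → P x) → HasSize P n → HasSize Q n
    size-cong P⊆Q Q⊆P (L , uL , mL , L≡n) =
      L , uL , (λ z → mk⇔ (λ q → to (mL z) (Q⊆P z q)) (λ m → P⊆Q z (from (mL z) m))) , L≡n

    size-image : (f : X → Y) {P : X → Set} {Q : Y → Set} {n : ℕ} →
      (∀ x y → P x → P y → f x ≡ f y → x ≡ y) → (∀ x → P x → Q (f x)) →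
      (∀ y → Q y → Σ X λ x → P x × y ≡ f x) → HasSize P n → HasSize Q n
    size-image f {P = P} {Q = Q} injective P→Q Q→P (L , uL , mL , L≡n) =
      map f L , map-unique (All.tabulate (λ {z} → from (mL z))) uL ,
      (λ y → mk⇔ (λ q → let (x , px , y≡fx) = Q→P y q in subst (_∈ map f L) (sym y≡fx) (∈-map⁺ f (to (mL x) px)))
                 (λ m → let (x , x∈L , y≡fx) = ∈-map⁻ f m in subst Q (sym y≡fx) (P→Q x (from (mL x) x∈L)))) ,
      trans (length-map f L) L≡n
      where
      map-unique : ∀ {xs} → All P xs → Unique xs → Unique (map f xs)
      map-unique [] [] = []
      map-unique {x ∷ xs} (px ∷ pxs) (x∉xs ∷ u) = apart pxs x∉xs ∷ map-unique pxs u
        where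
        apart : ∀ {zs} → All P zs → All (λ z → x ≢ z) zs → All (λ w → f x ≢ w) (map f zs)
        apart [] [] = []
        apart (pz ∷ pzs) (x≢z ∷ x∉zs) = (λ fx≡fz → x≢z (injective _ _ px pz fx≡fz)) ∷ apart pzs x∉zs

    size-split : {P R : X → Set} {n : ℕ} → HasSize P n → (R? : ∀ x → Dec (R x)) →
      Σ ℕ λ a → Σ ℕ λ b → HasSize (λ x → P x × R x) a × HasSize (λ x → P x × ¬ R x) b × a + b ≡ n
    size-split {P = P} {R} (L , uL , mL , L≡n) R? =
      length (filter R? L) , length (filter ¬R? L) , part R? , part ¬R? , trans (filter-length L) L≡n
      where
      ¬R? : ∀ x → Dec (¬ R x)
      ¬R? x = ¬? (R? x)
      part : {S : _ → Set} (S? : ∀ x → Dec (S x)) → HasSize (λ x → P x × S x) (length (filter S? L))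
      part S? = filter S? L , filter⁺ S? uL ,
        (λ z → mk⇔ (λ (p , s) → ∈-filter⁺ S? (to (mL z) p) s)
                   (λ m → let (z∈L , s) = ∈-filter⁻ S? m in from (mL z) z∈L , s)) , refl
      filter-length : ∀ xs → length (filter R? xs) + length (filter ¬R? xs) ≡ length xs
      filter-length [] = refl
      filter-length (x ∷ xs) with R? x
      ... | yes _ = cong suc (filter-length xs)
      ... | no  _ = trans (ℕP.+-suc _ _) (cong suc (filter-length xs))

    size-∅ : {P : X → Set} → (∀ x → ¬ P x) → HasSize P 0
    size-∅ ¬P = [] , [] , (λ z → mk⇔ (λ p → ⊥-elim (¬P z p)) (λ ())) , refl

    size-0⇒∅ : {P : X → Set} → HasSize P 0 → ∀ x → ¬ P x
    size-0⇒∅ ([] , _ , mL , _) x p with to (mL x) p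
    ... | ()

    size-suc⇒inhabited : {P : X → Set} {n : ℕ} → HasSize P (suc n) → Σ X P
    size-suc⇒inhabited (x ∷ _ , _ , mL , _) = x , from (mL x) (here refl)

    size-singleton : (x : X) → HasSize (_≡ x) 1
    size-singleton x = x ∷ [] , [] ∷ [] , (λ y → mk⇔ (λ { refl → here refl }) (λ { (here y≡x) → y≡x })) , refl

    size-⊎ : {P Q : X → Set} {a b : ℕ} → HasSize P a → HasSize Q b → (∀ x → P x → ¬ Q x) →
      HasSize (λ x → P x ⊎ Q x) (a + b)
    size-⊎ (L , uL , mL , refl) (M , uM , mM , refl) disjoint =
      L ++ M , ++⁺ uL uM (λ (z∈L , z∈M) → disjoint _ (from (mL _) z∈L) (from (mM _) z∈M)) ,
      (λ z → mk⇔ (λ { (inj₁ p) → ∈-++⁺ˡ (to (mL z) p) ; (inj₂ q) → ∈-++⁺ʳ L (to (mM z) q) })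
                 (λ m → Data.Sum.map (from (mL z)) (from (mM z)) (∈-++⁻ L m))) ,
      length-++ L

    size-× : {A : X → Set} {B : Y → Set} {a b : ℕ} → HasSize A a → HasSize B b →
      HasSize (λ (p : X × Y) → A (proj₁ p) × B (proj₂ p)) (a * b)
    size-× (L , uL , mL , refl) (M , uM , mM , refl) =
      cartesianProduct L M , cartesianProduct⁺ uL uM ,
      (λ (x , y) → mk⇔ (λ (a , b) → ∈-cartesianProduct⁺ (to (mL x) a) (to (mM y) b))
                       (λ m → let (x∈L , y∈M) = ∈-cartesianProduct⁻ L M m in from (mL x) x∈L , from (mM y) y∈M)) ,
      length-cartesianProduct L M

    size-Σ : {R : Y → Set} {P : Y → X → Set} {m n : ℕ} → HasSize R m → (∀ y → R y → HasSize (P y) n) →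
      HasSize (λ (p : X × Y) → R (proj₂ p) × P (proj₂ p) (proj₁ p)) (m * n)
    size-Σ {R = R} {P = P} {n = n} (L , uL , mL , refl) sizeP =
      size-cong (λ (x , y) (y∈L , p) → from (mL y) y∈L , p) (λ (x , y) (r , p) → to (mL y) r , p)
        (over L uL (All.tabulate (λ {y} → from (mL y))))
      where
      over : (ys : List _) → Unique ys → All R ys →
        HasSize (λ (p : _ × _) → proj₂ p ∈ ys × P (proj₂ p) (proj₁ p)) (length ys * n)
      over [] _ _ = size-∅ (λ _ ())
      over (y ∷ ys) (y∉ys ∷ u) (ry ∷ rys) =
        size-cong (λ { _ (inj₁ (refl , p)) → here refl , p ; _ (inj₂ (y'∈ys , p)) → there y'∈ys , p })
                  (λ { _ (here refl , p) → inj₁ (refl , p) ; _ (there y'∈ys , p) → inj₂ (y'∈ys , p) })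
          (size-⊎ (size-image (_, y) {Q = λ (x , y') → y' ≡ y × P y x} (λ _ _ _ _ → cong proj₁) (λ x p → refl , p)
                              (λ { (x , _) (refl , p) → x , p , refl }) (sizeP y ry))
                  (over ys u rys)
                  (λ { _ (refl , _) (y∈ys , _) → All.lookup y∉ys y∈ys refl }))

    size-Fin : (n : ℕ) → HasSize (λ (_ : Fin n) → ⊤) n
    size-Fin n = allFin n , allFin⁺ n , (λ z → mk⇔ (λ _ → ∈-allFin z) (λ _ → tt)) , length-tabulate (λ i → i)

    finite⇒↣Fin : {n : ℕ} → HasSize (λ (_ : X) → ⊤) n → X ↣ Fin n
    finite⇒↣Fin {X = X} (L , _ , mL , refl) = mk↣ {to = position} position-injective
      where
      position : X → Fin (length L)
      position z = index (to (mL z) tt)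
      position-injective : ∀ {x y} → position x ≡ position y → x ≡ y
      position-injective {x} {y} same =
        trans (lookup-index (to (mL x) tt)) (trans (cong (lookup L) same) (sym (lookup-index (to (mL y) tt))))

    finite⇒≟ : {n : ℕ} → HasSize (λ (_ : X) → ⊤) n → DecidableEquality X
    finite⇒≟ finite = FinP.inj⇒≟ (finite⇒↣Fin finite)

  module _ {X : Set} (_≟_ : DecidableEquality X) where
    opaque
      size⇒dec : {P : X → Set} {n : ℕ} → HasSize P n → ∀ x → Dec (P x)
      size⇒dec (L , _ , mL , _) x with ∈?-with _≟_ x L
      ... | yes x∈L = yes (from (mL x) x∈L)
      ... | no  x∉L = no (λ p → x∉L (to (mL x) p))

      size-remove : {P : X → Set} {n : ℕ} {x : X} → HasSize P (suc n) → P x → HasSize (λ y → P y × y ≢ x) n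
      size-remove {P = P} {n = n} {x = x} sP px with size-split sP (λ y → ¬? (y ≟ x))
      ... | a , b , sa , sb , a+b≡1+n = subst (HasSize _) a≡n sa
        where
        b≡1 : b ≡ 1
        b≡1 = size-unique sb (size-cong (λ { y refl → px , λ x≢x → x≢x refl })
                                         (λ y (_ , ¬y≢x) → decidable-stable (y ≟ x) ¬y≢x) (size-singleton x))
        a≡n : a ≡ n
        a≡n = ℕP.suc-injective (trans (ℕP.+-comm 1 a) (trans (cong (a +_) (sym b≡1)) a+b≡1+n))

      size-∖ : {U A : X → Set} {N a : ℕ} → HasSize U N → HasSize (λ x → U x × A x) a →
        Σ ℕ λ n → HasSize (λ x → U x × ¬ A x) n × n + a ≡ N
      size-∖ {U = U} {A = A} {a = a} sU sUA with size-split sU (size⇒dec sUA)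
      ... | a' , n , sa' , sn , a'+n≡N =
        n , size-cong (λ x (u , ¬ua) → u , λ a → ¬ua (u , a)) (λ x (u , ¬a) → u , λ (_ , a) → ¬a a) sn ,
        trans (ℕP.+-comm n _) (trans (cong (_+ n) (sym a'≡a)) a'+n≡N)
        where a'≡a : a' ≡ a
              a'≡a = size-unique sa' (size-cong (λ x ua → proj₁ ua , ua) (λ x → proj₂) sUA)

      inclusion–exclusion : {A B : X → Set} {N a b c : ℕ} → HasSize (λ (_ : X) → ⊤) N →
        HasSize A a → HasSize B b → HasSize (λ x → A x × B x) c →
        Σ ℕ λ n → HasSize (λ x → ¬ A x × ¬ B x) n × n + a + b ≡ N + c
      inclusion–exclusion {A} {B} {N} {a} {b} {c} sU sA sB sAB
        with size-∖ sU (size-cong (λ _ a → tt , a) (λ _ → proj₂) sA)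
           | size-∖ sB (size-cong (λ _ (a , b) → b , a) (λ _ (b , a) → a , b) sAB)
      ... | n₁ , s¬A , n₁+a≡N | d , sB∖A , d+c≡b
        with size-∖ s¬A (size-cong (λ _ (b , ¬a) → (tt , ¬a) , b) (λ _ ((_ , ¬a) , b) → b , ¬a) sB∖A)
      ... | n , s¬A¬B , n+d≡n₁ =
        n , size-cong (λ _ ((_ , ¬a) , ¬b) → ¬a , ¬b) (λ _ (¬a , ¬b) → (tt , ¬a) , ¬b) s¬A¬B , (begin
          n + a + b        ≡⟨ cong (n + a +_) (sym d+c≡b) ⟩
          n + a + (d + c)  ≡⟨ solve 4 (λ n a d c → n :+ a :+ (d :+ c) := (n :+ d) :+ a :+ c) refl n a d c ⟩
          (n + d) + a + c  ≡⟨ cong (λ m → m + a + c) n+d≡n₁ ⟩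
          n₁ + a + c       ≡⟨ cong (_+ c) n₁+a≡N ⟩
          N + c            ∎)
        where open ≡-Reasoning
              open +-*-Solver

      size-⊆-full : {P Q : X → Set} {n : ℕ} → (∀ x → P x → Q x) → HasSize P n → HasSize Q n → ∀ x → Q x → P x
      size-⊆-full {P = P} {Q = Q} P⊆Q sP sQ x qx with size⇒dec sP x
      ... | yes px = px
      ... | no ¬px with size-∖ sQ (size-cong (λ y p → P⊆Q y p , p) (λ _ → proj₂) sP)
      ... | zero  , sQ∖P , _ = ⊥-elim (size-0⇒∅ sQ∖P x (qx , ¬px))
      ... | suc m , _ , 1+m+n≡n = ⊥-elim (ℕP.<⇒≢ (ℕP.m<n+m _ (s≤s z≤n)) (sym 1+m+n≡n))

      ⊈⇒witness : {P P' : X → Set} {n : ℕ} → HasSize P' n → (∀ x → Dec (P x)) →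
        ¬ (∀ x → P' x → P x) → Σ X λ x → P' x × ¬ P x
      ⊈⇒witness {P = P} {P' = P'} sP' P? P'⊈P with size-split sP' (λ x → ¬? (P? x))
      ... | suc _ , _ , s , _ , _ = size-suc⇒inhabited s
      ... | zero  , _ , s , _ , _ =
        ⊥-elim (P'⊈P λ x p'x → decidable-stable (P? x) (λ ¬px → size-0⇒∅ s x (p'x , ¬px)))

  opaque
    injective⇒surjective : {n : ℕ} (f : Fin n → Fin n) → (∀ i j → f i ≡ f j → i ≡ j) → ∀ k → Σ (Fin n) λ j → k ≡ f j
    injective⇒surjective {n = n} f injective k = size-⊆-full Fin._≟_ (λ _ _ → tt) image (size-Fin n) k tt
      where
      image : HasSize (λ k → Σ (Fin n) λ j → k ≡ f j) n
      image = size-image f (λ i j _ _ → injective i j) (λ i _ → i , refl) (λ y (i , y≡fi) → i , tt , y≡fi) (size-Fin n)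

    minimal-witness : {P : ℕ → Set} → (∀ n → Dec (P n)) → ∀ n → P n → Σ ℕ λ m → P m × (∀ k → k < m → ¬ P k)
    minimal-witness {P} P? n pn = search n 0 (λ _ ()) pn
      where
      search : ∀ fuel i → (∀ k → k < i → ¬ P k) → P (i + fuel) → Σ ℕ λ m → P m × (∀ k → k < m → ¬ P k)
      search fuel i below with P? i
      ... | yes pi = λ _ → i , pi , below
      search zero i below | no ¬pi = λ p → ⊥-elim (¬pi (subst P (ℕP.+-identityʳ i) p))
      search (suc fuel) i below | no ¬pi = λ p → search fuel (suc i) below′ (subst P (ℕP.+-suc i fuel) p)
        where
        below′ : ∀ k → k < suc i → ¬ P k
        below′ k k<1+i with ℕP.m≤n⇒m<n∨m≡n (ℕP.≤-pred k<1+i)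
        ... | inj₁ k<i  = below k k<i
        ... | inj₂ refl = ¬pi

open FiniteSets

module NatFacts where
  open import Data.Nat as ℕ using (ℕ; zero; suc; _+_; _*_; _≤_; _^_; z≤n; s≤s; NonZero)
  import Data.Nat.Properties as ℕP
  open import Data.Nat.Primality using (prime⇒nonTrivial)
  open import Data.Nat.Solver using (module +-*-Solver)
  open import Data.Fin as Fin using (Fin; toℕ)
  import Data.Fin.Properties as FinP
  open import Data.Product using (_×_; _,_)
  open import Data.Sum using (_⊎_; inj₁; inj₂)
  open import Relation.Binary.PropositionalEquality
  open +-*-Solver
  open ≡-Reasoning

  prime-power⇒2≤ : ∀ {q} → IsPrimePower q → 2 ≤ q
  prime-power⇒2≤ (p , e , p-prime , 1≤e , q≡pᵉ) =
    subst (2 ≤_) (sym q≡pᵉ) (ℕP.≤-trans 2≤p (subst (_≤ p ^ e) (ℕP.*-identityʳ p) (ℕP.^-monoʳ-≤ p 1≤e)))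
    where
    2≤p : 2 ≤ p
    2≤p = ℕ.nonTrivial⇒n>1 p {{prime⇒nonTrivial p-prime}}
    instance
      p-nonZero : NonZero p
      p-nonZero = ℕ.>-nonZero (ℕP.≤-trans (s≤s z≤n) 2≤p)

  negF-+ : ∀ {n} (i : Fin n) → (toℕ i ≡ 0 × toℕ (negF i) ≡ 0) ⊎ (toℕ (negF i) ℕ.+ toℕ i ≡ n)
  negF-+ {suc n} Fin.zero    = inj₁ (refl , refl)
  negF-+ {suc n} (Fin.suc k) = inj₂ (cong suc (trans (cong (ℕ._+ suc (toℕ k)) (FinP.opposite-prop k)) (ℕP.m∸n+n≡m (FinP.toℕ<n k))))

  negF-involutive : ∀ {n} (i : Fin n) → negF (negF i) ≡ i
  negF-involutive {suc n} Fin.zero    = refl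
  negF-involutive {suc n} (Fin.suc k) = cong Fin.suc (FinP.opposite-involutive k)

  degree-arithmetic : ∀ {n t q₁ Q} → n + t * Q ≡ suc q₁ * Q * t → n ≡ Q * (t * q₁)
  degree-arithmetic {n} {t} {q₁} {Q} eq = ℕP.+-cancelʳ-≡ (t * Q) n (Q * (t * q₁)) (begin
    n + t * Q              ≡⟨ eq ⟩
    suc q₁ * Q * t         ≡⟨ solve 3 (λ t q₁ Q → (con 1 :+ q₁) :* Q :* t := Q :* (t :* q₁) :+ t :* Q) refl t q₁ Q ⟩
    Q * (t * q₁) + t * Q   ∎)

  λ₂-arithmetic : ∀ {n t q₁ X} → n + t * (X * suc q₁) + t * (X * suc q₁) ≡ suc q₁ * (X * suc q₁) * t + t * X →
    n ≡ X * q₁ * (t * q₁)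
  λ₂-arithmetic {n} {t} {q₁} {X} eq = ℕP.+-cancelʳ-≡ (t * (X * suc q₁) + t * (X * suc q₁)) n (X * q₁ * (t * q₁)) (begin
    n + (t * (X * suc q₁) + t * (X * suc q₁))          ≡⟨ sym (ℕP.+-assoc n _ _) ⟩
    n + t * (X * suc q₁) + t * (X * suc q₁)            ≡⟨ eq ⟩
    suc q₁ * (X * suc q₁) * t + t * X                  ≡⟨ solve 3 (λ t q₁ X → (con 1 :+ q₁) :* (X :* (con 1 :+ q₁)) :* t :+ t :* X
                                                                  := X :* q₁ :* (t :* q₁) :+ (t :* (X :* (con 1 :+ q₁)) :+ t :* (X :* (con 1 :+ q₁))))
                                                                refl t q₁ X ⟩
    X * q₁ * (t * q₁) + (t * (X * suc q₁) + t * (X * suc q₁)) ∎)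

  -- Multiplying by q₁ turns t and c into the known quantities t q₁ = q₁ Q + Q₀ and q₁ c = Q₀, where Q = 1 + Q₀.
  λ₁-arithmetic : ∀ {n t c q₁ Q₀ a₀} → q₁ * c ≡ Q₀ → q₁ * suc Q₀ ≡ suc a₀ → t * q₁ ≡ suc a₀ + Q₀ →
    n + t * suc Q₀ + t * suc Q₀ ≡ suc q₁ * suc Q₀ * t + c * suc Q₀ → n ≡ suc Q₀ * a₀
  λ₁-arithmetic {n} {t} {c} {q₁} {Q₀} {a₀} q₁c≡Q₀ q₁Q≡1+a₀ tq₁≡ eq =
    ℕP.*-cancelˡ-≡ n (suc Q₀ * a₀) q₁ ⦃ q₁-nonZero ⦄ (ℕP.+-cancelʳ-≡ (T * suc Q₀ + T * suc Q₀) (q₁ * n) (q₁ * (suc Q₀ * a₀)) (begin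
      q₁ * n + (T * suc Q₀ + T * suc Q₀)                       ≡⟨ cong (λ x → q₁ * n + (x * suc Q₀ + x * suc Q₀)) (sym tq₁≡) ⟩
      q₁ * n + (t * q₁ * suc Q₀ + t * q₁ * suc Q₀)             ≡⟨ solve 4 (λ n t q₁ Q → q₁ :* n :+ (t :* q₁ :* Q :+ t :* q₁ :* Q) := q₁ :* (n :+ t :* Q :+ t :* Q)) refl n t q₁ (suc Q₀) ⟩
      q₁ * (n + t * suc Q₀ + t * suc Q₀)                       ≡⟨ cong (q₁ *_) eq ⟩
      q₁ * (suc q₁ * suc Q₀ * t + c * suc Q₀)                  ≡⟨ solve 4 (λ t c q₁ Q → q₁ :* ((con 1 :+ q₁) :* Q :* t :+ c :* Q) := t :* q₁ :* (Q :+ q₁ :* Q) :+ q₁ :* c :* Q) refl t c q₁ (suc Q₀) ⟩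
      t * q₁ * (suc Q₀ + q₁ * suc Q₀) + q₁ * c * suc Q₀        ≡⟨ cong₂ (λ x y → x * (suc Q₀ + y) + q₁ * c * suc Q₀) tq₁≡ q₁Q≡1+a₀ ⟩
      T * (suc Q₀ + suc a₀) + q₁ * c * suc Q₀                  ≡⟨ cong (λ x → T * (suc Q₀ + suc a₀) + x * suc Q₀) q₁c≡Q₀ ⟩
      T * (suc Q₀ + suc a₀) + Q₀ * suc Q₀                      ≡⟨ solve 2 (λ a₀ Q₀ → (con 1 :+ a₀ :+ Q₀) :* ((con 1 :+ Q₀) :+ (con 1 :+ a₀)) :+ Q₀ :* (con 1 :+ Q₀)
                                                                         := (con 1 :+ a₀) :* a₀ :+ ((con 1 :+ a₀ :+ Q₀) :* (con 1 :+ Q₀) :+ (con 1 :+ a₀ :+ Q₀) :* (con 1 :+ Q₀))) refl a₀ Q₀ ⟩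
      suc a₀ * a₀ + (T * suc Q₀ + T * suc Q₀)                  ≡⟨ cong (λ x → x * a₀ + (T * suc Q₀ + T * suc Q₀)) (sym q₁Q≡1+a₀) ⟩
      q₁ * suc Q₀ * a₀ + (T * suc Q₀ + T * suc Q₀)             ≡⟨ cong (_+ (T * suc Q₀ + T * suc Q₀)) (ℕP.*-assoc q₁ (suc Q₀) a₀) ⟩
      q₁ * (suc Q₀ * a₀) + (T * suc Q₀ + T * suc Q₀)           ∎))
    where
    T = suc a₀ + Q₀
    q₁-nonZero : NonZero q₁
    q₁-nonZero = ℕP.m*n≢0⇒m≢0 q₁ ⦃ subst NonZero (sym q₁Q≡1+a₀) _ ⦄

open NatFacts

module FiniteField (𝔽 : Field) {n : ℕ} (finite : HasSize (λ (_ : Field.Carrier 𝔽) → ⊤) n) where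
  open import Algebra.Bundles using (CommutativeRing)
  open import Data.Nat as ℕ using (ℕ; zero; suc; _<_; _≤_; _∸_; z≤n; s≤s; NonZero)
  import Data.Nat.Properties as ℕP
  open import Data.Nat.DivMod using (m≡m%n+[m/n]*n; m%n<n)
  open import Data.Nat.Divisibility using (_∣_; divides; _∣0; ∣-refl; ∣m∣n⇒∣m+n)
  open import Data.Fin as Fin using (Fin; toℕ; fromℕ<)
  import Data.Fin.Properties as FinP
  open import Data.Nat.Induction using (<-rec)
  open import Data.Product using (Σ; _×_; _,_; proj₁; proj₂)
  open import Function.Base using (_∘_)
  open import Function.Bundles using (Injection)
  open import Data.Empty using (⊥-elim)
  open import Data.Unit using (⊤; tt)
  open import Relation.Binary using (tri<; tri≈; tri>)
  open import Relation.Binary.PropositionalEquality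
  open import Relation.Nullary using (¬_; Dec)
  open import Relation.Nullary.Decidable using (_×-dec_)

  open FieldTheory 𝔽 public

  commutativeRing : CommutativeRing _ _
  commutativeRing = record { isCommutativeRing = isCommutativeRing }

  open CommutativeRing commutativeRing public
    using (+-identityˡ; +-identityʳ; -‿inverseʳ; *-assoc; *-comm; *-identityˡ; *-identityʳ; distribʳ; zeroˡ; zeroʳ)
  open import Algebra.Properties.Ring (CommutativeRing.ring commutativeRing) public
    using (-‿involutive; -‿distribˡ-*; -‿distribʳ-*; -0#≈0#)
  open IntegerCoefficientSolver commutativeRing public using (solve; _:=_; _:+_; _:*_; :-_; _:-_)
  open ≡-Reasoning

  infix 4 _≟_
  _≟_ : (x y : F) → Dec (x ≡ y)
  _≟_ = finite⇒≟ finite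

  infixl 6 _-_
  _-_ : F → F → F
  a - b = a + - b

  1≢0 : 1# ≢ 0#
  1≢0 1≡0 = 0≢1 (sym 1≡0)

  ⁻¹-inverseˡ : ∀ x → x ≢ 0# → x ⁻¹ * x ≡ 1#
  ⁻¹-inverseˡ x x≢0 = trans (*-comm _ _) (⁻¹-inverse x x≢0)

  *-cancelˡ : ∀ {x a b} → x ≢ 0# → x * a ≡ x * b → a ≡ b
  *-cancelˡ {x} {a} {b} x≢0 xa≡xb = begin
    a                ≡⟨ sym (*-identityˡ a) ⟩
    1# * a           ≡⟨ cong (_* a) (sym (⁻¹-inverseˡ x x≢0)) ⟩
    x ⁻¹ * x * a     ≡⟨ *-assoc _ _ _ ⟩
    x ⁻¹ * (x * a)   ≡⟨ cong (x ⁻¹ *_) xa≡xb ⟩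
    x ⁻¹ * (x * b)   ≡⟨ sym (*-assoc _ _ _) ⟩
    x ⁻¹ * x * b     ≡⟨ cong (_* b) (⁻¹-inverseˡ x x≢0) ⟩
    1# * b           ≡⟨ *-identityˡ b ⟩
    b                ∎

  *-cancelʳ : ∀ {x a b} → x ≢ 0# → a * x ≡ b * x → a ≡ b
  *-cancelʳ {x} {a} {b} x≢0 ax≡bx = *-cancelˡ x≢0 (trans (*-comm x a) (trans ax≡bx (*-comm b x)))

  *-nonzero : ∀ {x y} → x ≢ 0# → y ≢ 0# → x * y ≢ 0#
  *-nonzero {x} {y} x≢0 y≢0 xy≡0 = y≢0 (*-cancelˡ x≢0 (trans xy≡0 (sym (zeroʳ x))))

  ⁻¹-unique : ∀ {x y} → x ≢ 0# → x * y ≡ 1# → x ⁻¹ ≡ y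
  ⁻¹-unique {x} x≢0 xy≡1 = *-cancelˡ x≢0 (trans (⁻¹-inverse x x≢0) (sym xy≡1))

  ⁻¹-nonzero : ∀ {x} → x ≢ 0# → x ⁻¹ ≢ 0#
  ⁻¹-nonzero {x} x≢0 x⁻¹≡0 = 0≢1 (trans (sym (zeroʳ x)) (trans (cong (x *_) (sym x⁻¹≡0)) (⁻¹-inverse x x≢0)))

  ⁻¹-involutive : ∀ {x} → x ≢ 0# → x ⁻¹ ⁻¹ ≡ x
  ⁻¹-involutive x≢0 = ⁻¹-unique (⁻¹-nonzero x≢0) (⁻¹-inverseˡ _ x≢0)

  ⁻¹*[*]-cancel : ∀ {x} y → x ≢ 0# → x ⁻¹ * (x * y) ≡ y
  ⁻¹*[*]-cancel {x} y x≢0 = trans (sym (*-assoc _ _ _)) (trans (cong (_* y) (⁻¹-inverseˡ x x≢0)) (*-identityˡ y))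

  *[⁻¹*]-cancel : ∀ {x} y → x ≢ 0# → x * (x ⁻¹ * y) ≡ y
  *[⁻¹*]-cancel {x} y x≢0 = trans (sym (*-assoc _ _ _)) (trans (cong (_* y) (⁻¹-inverse x x≢0)) (*-identityˡ y))

  x-y≡0⇒x≡y : ∀ {x y} → x - y ≡ 0# → x ≡ y
  x-y≡0⇒x≡y {x} {y} x-y≡0 = begin
    x             ≡⟨ solve 2 (λ x y → x := (x :- y) :+ y) refl x y ⟩
    (x - y) + y   ≡⟨ cong (_+ y) x-y≡0 ⟩
    0# + y        ≡⟨ +-identityˡ y ⟩
    y             ∎

  ^-distribˡ-+-* : ∀ x m n → x ^ᶠ (m ℕ.+ n) ≡ x ^ᶠ m * x ^ᶠ n
  ^-distribˡ-+-* x zero    n = sym (*-identityˡ _)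
  ^-distribˡ-+-* x (suc m) n = trans (cong (x *_) (^-distribˡ-+-* x m n)) (sym (*-assoc _ _ _))

  1^n≡1 : ∀ n → 1# ^ᶠ n ≡ 1#
  1^n≡1 zero    = refl
  1^n≡1 (suc n) = trans (*-identityˡ _) (1^n≡1 n)

  ^-distribʳ-* : ∀ x y n → (x * y) ^ᶠ n ≡ x ^ᶠ n * y ^ᶠ n
  ^-distribʳ-* x y zero    = sym (*-identityˡ 1#)
  ^-distribʳ-* x y (suc n) = trans (cong ((x * y) *_) (^-distribʳ-* x y n))
    (solve 4 (λ x y a b → (x :* y) :* (a :* b) := (x :* a) :* (y :* b)) refl x y (x ^ᶠ n) (y ^ᶠ n))

  ^-*-assoc : ∀ x m n → (x ^ᶠ m) ^ᶠ n ≡ x ^ᶠ (m ℕ.* n)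
  ^-*-assoc x zero    n = 1^n≡1 n
  ^-*-assoc x (suc m) n = begin
    (x * x ^ᶠ m) ^ᶠ n            ≡⟨ ^-distribʳ-* x (x ^ᶠ m) n ⟩
    x ^ᶠ n * (x ^ᶠ m) ^ᶠ n       ≡⟨ cong (x ^ᶠ n *_) (^-*-assoc x m n) ⟩
    x ^ᶠ n * x ^ᶠ (m ℕ.* n)      ≡⟨ sym (^-distribˡ-+-* x n (m ℕ.* n)) ⟩
    x ^ᶠ (n ℕ.+ m ℕ.* n)         ∎

  ^-nonzero : ∀ {x} n → x ≢ 0# → x ^ᶠ n ≢ 0#
  ^-nonzero zero    x≢0 = 1≢0
  ^-nonzero (suc n) x≢0 = *-nonzero x≢0 (^-nonzero n x≢0)

  ^≡^⇒^∸≡1 : ∀ {x} → x ≢ 0# → ∀ m n → m ≤ n → x ^ᶠ m ≡ x ^ᶠ n → x ^ᶠ (n ∸ m) ≡ 1#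
  ^≡^⇒^∸≡1 {x} x≢0 m n m≤n xᵐ≡xⁿ = *-cancelˡ (^-nonzero m x≢0) (begin
    x ^ᶠ m * x ^ᶠ (n ∸ m)    ≡⟨ sym (^-distribˡ-+-* x m (n ∸ m)) ⟩
    x ^ᶠ (m ℕ.+ (n ∸ m))     ≡⟨ cong (x ^ᶠ_) (ℕP.m+[n∸m]≡n m≤n) ⟩
    x ^ᶠ n                   ≡⟨ sym xᵐ≡xⁿ ⟩
    x ^ᶠ m                   ≡⟨ sym (*-identityʳ _) ⟩
    x ^ᶠ m * 1#              ∎)

  IsOrder : F → ℕ → Set
  IsOrder g o = 0 < o × g ^ᶠ o ≡ 1# × (∀ k → 0 < k → k < o → g ^ᶠ k ≢ 1#)

  opaque
    period : ∀ {g} → g ≢ 0# → Σ ℕ λ e → 0 < e × g ^ᶠ e ≡ 1#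
    period {g} g≢0 =
      let (i , j , i<j , same) = FinP.pigeonhole (ℕP.n<1+n n) (Injection.to (finite⇒↣Fin finite) ∘ powers) in
      toℕ j ∸ toℕ i , ℕP.m<n⇒0<n∸m i<j , ^≡^⇒^∸≡1 g≢0 _ _ (ℕP.<⇒≤ i<j) (Injection.injective (finite⇒↣Fin finite) same)
      where
      powers : Fin (suc n) → F
      powers i = g ^ᶠ toℕ i

    order-exists : ∀ {g} → g ≢ 0# → Σ ℕ (IsOrder g)
    order-exists {g} g≢0 with period g≢0
    ... | e , 0<e , gᵉ≡1 with minimal-witness (λ k → (0 ℕ.<? k) ×-dec (g ^ᶠ k ≟ 1#)) e (0<e , gᵉ≡1)
    ... | o , (0<o , gᵒ≡1) , below = o , 0<o , gᵒ≡1 , λ k 0<k k<o gᵏ≡1 → below k k<o (0<k , gᵏ≡1)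

  module Order {g o} ⦃ _ : NonZero o ⦄ (g≢0 : g ≢ 0#) (order : IsOrder g o) where
    gᵒ≡1 : g ^ᶠ o ≡ 1#
    gᵒ≡1 = proj₁ (proj₂ order)

    ^-% : ∀ a → g ^ᶠ a ≡ g ^ᶠ (a ℕ.% o)
    ^-% a = begin
      g ^ᶠ a                                 ≡⟨ cong (g ^ᶠ_) (m≡m%n+[m/n]*n a o) ⟩
      g ^ᶠ (a ℕ.% o ℕ.+ a ℕ./ o ℕ.* o)       ≡⟨ ^-distribˡ-+-* g (a ℕ.% o) _ ⟩
      g ^ᶠ (a ℕ.% o) * g ^ᶠ (a ℕ./ o ℕ.* o)  ≡⟨ cong (λ m → g ^ᶠ (a ℕ.% o) * g ^ᶠ m) (ℕP.*-comm (a ℕ./ o) o) ⟩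
      g ^ᶠ (a ℕ.% o) * g ^ᶠ (o ℕ.* (a ℕ./ o)) ≡⟨ cong (g ^ᶠ (a ℕ.% o) *_) (sym (^-*-assoc g o (a ℕ./ o))) ⟩
      g ^ᶠ (a ℕ.% o) * (g ^ᶠ o) ^ᶠ (a ℕ./ o) ≡⟨ cong (λ x → g ^ᶠ (a ℕ.% o) * x ^ᶠ (a ℕ./ o)) gᵒ≡1 ⟩
      g ^ᶠ (a ℕ.% o) * 1# ^ᶠ (a ℕ./ o)       ≡⟨ cong (g ^ᶠ (a ℕ.% o) *_) (1^n≡1 (a ℕ./ o)) ⟩
      g ^ᶠ (a ℕ.% o) * 1#                    ≡⟨ *-identityʳ _ ⟩
      g ^ᶠ (a ℕ.% o)                         ∎

    ^≡1⇒∣ : ∀ a → g ^ᶠ a ≡ 1# → o ∣ a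
    ^≡1⇒∣ a gᵃ≡1 with a ℕ.% o in a%o≡r
    ... | zero  = divides (a ℕ./ o) (trans (m≡m%n+[m/n]*n a o) (cong (ℕ._+ a ℕ./ o ℕ.* o) a%o≡r))
    ... | suc r = ⊥-elim (proj₂ (proj₂ order) (suc r) (s≤s z≤n) (subst (_< o) a%o≡r (m%n<n a o))
                          (trans (sym (trans (^-% a) (cong (g ^ᶠ_) a%o≡r))) gᵃ≡1))

    ∣⇒^≡1 : ∀ a → o ∣ a → g ^ᶠ a ≡ 1#
    ∣⇒^≡1 a (divides m a≡m*o) = begin
      g ^ᶠ a            ≡⟨ cong (g ^ᶠ_) (trans a≡m*o (ℕP.*-comm m o)) ⟩
      g ^ᶠ (o ℕ.* m)    ≡⟨ sym (^-*-assoc g o m) ⟩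
      (g ^ᶠ o) ^ᶠ m     ≡⟨ cong (_^ᶠ m) gᵒ≡1 ⟩
      1# ^ᶠ m           ≡⟨ 1^n≡1 m ⟩
      1#                ∎

    ^-injective : ∀ a b → a < o → b < o → g ^ᶠ a ≡ g ^ᶠ b → a ≡ b
    ^-injective a b a<o b<o gᵃ≡gᵇ with ℕP.<-cmp a b
    ... | tri≈ _ a≡b _ = a≡b
    ... | tri< a<b _ _ = ⊥-elim (proj₂ (proj₂ order) (b ∸ a) (ℕP.m<n⇒0<n∸m a<b)
                                   (ℕP.≤-<-trans (ℕP.m∸n≤m b a) b<o) (^≡^⇒^∸≡1 g≢0 a b (ℕP.<⇒≤ a<b) gᵃ≡gᵇ))
    ... | tri> _ _ b<a = ⊥-elim (proj₂ (proj₂ order) (a ∸ b) (ℕP.m<n⇒0<n∸m b<a)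
                                   (ℕP.≤-<-trans (ℕP.m∸n≤m a b) a<o) (^≡^⇒^∸≡1 g≢0 b a (ℕP.<⇒≤ b<a) (sym gᵃ≡gᵇ)))

    Orbit : F → F → Set
    Orbit x y = Σ (Fin o) λ i → y ≡ x * g ^ᶠ toℕ i

    orbit-size : ∀ {x} → x ≢ 0# → HasSize (Orbit x) o
    orbit-size {x} x≢0 = size-image (λ (i : Fin o) → x * g ^ᶠ toℕ i)
      (λ i j _ _ xgⁱ≡xgʲ → FinP.toℕ-injective (^-injective _ _ (FinP.toℕ<n i) (FinP.toℕ<n j) (*-cancelˡ x≢0 xgⁱ≡xgʲ)))
      (λ i _ → i , refl) (λ y (i , y≡xgⁱ) → i , tt , y≡xgⁱ) (size-Fin o)

    -- Multiplying by g^(o-1) undoes multiplication by g.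
    orbit-*g⁻¹ : ∀ {x y} → Orbit x (y * g) → Orbit x y
    orbit-*g⁻¹ {x} {y} (i , yg≡xgⁱ) = fromℕ< (m%n<n k o) , (begin
      y                            ≡⟨ sym (*-identityʳ y) ⟩
      y * 1#                       ≡⟨ cong (y *_) (sym (trans (cong (g ^ᶠ_) 1+o'≡o) gᵒ≡1)) ⟩
      y * (g * g ^ᶠ o')            ≡⟨ sym (*-assoc _ _ _) ⟩
      y * g * g ^ᶠ o'              ≡⟨ cong (_* g ^ᶠ o') yg≡xgⁱ ⟩
      x * g ^ᶠ toℕ i * g ^ᶠ o'     ≡⟨ *-assoc _ _ _ ⟩
      x * (g ^ᶠ toℕ i * g ^ᶠ o')   ≡⟨ cong (x *_) (sym (^-distribˡ-+-* g (toℕ i) o')) ⟩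
      x * g ^ᶠ k                   ≡⟨ cong (x *_) (trans (^-% k) (cong (g ^ᶠ_) (sym (FinP.toℕ-fromℕ< (m%n<n k o))))) ⟩
      x * g ^ᶠ toℕ (fromℕ< (m%n<n k o)) ∎)
      where
      o' = o ∸ 1
      1+o'≡o : suc o' ≡ o
      1+o'≡o = ℕP.m+[n∸m]≡n (proj₁ order)
      k = toℕ i ℕ.+ o'

    *^-closed : (S : F → Set) → (∀ x → S x → S (x * g)) → ∀ x k → S x → S (x * g ^ᶠ k)
    *^-closed S closed x zero    sx = subst S (sym (*-identityʳ x)) sx
    *^-closed S closed x (suc k) sx =
      subst S (solve 3 (λ x a g → (x :* a) :* g := x :* (g :* a)) refl x (g ^ᶠ k) g) (closed _ (*^-closed S closed x k sx))

    -- S is a disjoint union of orbits, each of size o.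
    order∣size : ∀ s (S : F → Set) → (∀ x → S x → x ≢ 0#) → (∀ x → S x → S (x * g)) → HasSize S s → o ∣ s
    order∣size = <-rec _ step
      where
      step : ∀ s → (∀ {s'} → s' < s → ∀ S → (∀ x → S x → x ≢ 0#) → (∀ x → S x → S (x * g)) → HasSize S s' → o ∣ s') →
             ∀ S → (∀ x → S x → x ≢ 0#) → (∀ x → S x → S (x * g)) → HasSize S s → o ∣ s
      step zero    _   S nonzero closed sS = o ∣0
      step (suc s) rec S nonzero closed sS with size-suc⇒inhabited sS
      ... | x , sx with size-split sS (λ y → FinP.any? (λ (i : Fin o) → y ≟ x * g ^ᶠ toℕ i))
      ... | a , b , sa , sb , a+b≡1+s = subst (o ∣_) a+b≡1+s (∣m∣n⇒∣m+n (subst (o ∣_) (sym a≡o) ∣-refl) o∣b)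
        where
        a≡o : a ≡ o
        a≡o = size-unique sa (size-cong (λ y (i , y≡xgⁱ) → subst S (sym y≡xgⁱ) (*^-closed S closed x (toℕ i) sx) , (i , y≡xgⁱ))
                                        (λ _ → proj₂) (orbit-size (nonzero x sx)))
        b<1+s : b < suc s
        b<1+s = subst (b <_) a+b≡1+s (subst (λ m → b < m ℕ.+ b) (sym a≡o) (ℕP.m<n+m b (proj₁ order)))
        o∣b : o ∣ b
        o∣b = rec b<1+s (λ y → S y × ¬ Orbit x y) (λ y (sy , _) → nonzero y sy)
                (λ y (sy , y∉) → closed y sy , λ yg∈ → y∉ (orbit-*g⁻¹ yg∈)) sb

  closed⇒^size≡1 : ∀ {g s} (S : F → Set) → g ≢ 0# → (∀ x → S x → x ≢ 0#) → (∀ x → S x → S (x * g)) →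
    HasSize S s → g ^ᶠ s ≡ 1#
  closed⇒^size≡1 {g} {s} S g≢0 nonzero closed sS =
    let (o , order) = order-exists g≢0 ; open Order ⦃ ℕ.>-nonZero (proj₁ order) ⦄ g≢0 order in
    ∣⇒^≡1 s (order∣size s S nonzero closed sS)

module FiniteSubfield (𝔽 : Field) {n : ℕ} (finite : HasSize (λ (_ : Field.Carrier 𝔽) → ⊤) n)
  (K : Field.Carrier 𝔽 → Set) (subfield : FieldTheory.IsSubfield 𝔽 K) {q : ℕ} (sizeK : HasSize K q) where
  open import Data.Nat as ℕ using (ℕ; zero; suc; _^_; NonZero)
  import Data.Nat.Properties as ℕP
  open import Data.Vec using (Vec; []; _∷_; zipWith)
  import Data.Vec.Properties as VecP
  open import Data.Vec.Relation.Unary.All using (All; []; _∷_)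
  open import Data.Product using (Σ; _×_; _,_; proj₁; proj₂)
  open import Data.Empty using (⊥-elim)
  open import Data.Unit using (⊤; tt)
  open import Relation.Binary.PropositionalEquality
  open import Relation.Nullary using (¬_; yes; no)

  open FiniteField 𝔽 finite
  open ≡-Reasoning

  K-0# : K 0#
  K-0# = proj₁ subfield
  K-1# : K 1#
  K-1# = proj₁ (proj₂ subfield)
  K-+ : ∀ x y → K x → K y → K (x + y)
  K-+ = proj₁ (proj₂ (proj₂ subfield))
  K-* : ∀ x y → K x → K y → K (x * y)
  K-* = proj₁ (proj₂ (proj₂ (proj₂ subfield)))
  K-neg : ∀ x → K x → K (- x)
  K-neg = proj₁ (proj₂ (proj₂ (proj₂ (proj₂ subfield))))
  K-⁻¹ : ∀ x → K x → x ≢ 0# → K (x ⁻¹)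
  K-⁻¹ = proj₂ (proj₂ (proj₂ (proj₂ (proj₂ subfield))))

  K-^ : ∀ x n → K x → K (x ^ᶠ n)
  K-^ x zero    kx = K-1#
  K-^ x (suc n) kx = K-* _ _ kx (K-^ x n kx)

  K-sub : ∀ x y → K x → K y → K (x - y)
  K-sub x y kx ky = K-+ x (- y) kx (K-neg y ky)

  module Subspace {P : F → Set} (subspace : IsSubspace K P) where
    0∈ : P 0#
    0∈ = proj₁ subspace
    +-closed : ∀ x y → P x → P y → P (x + y)
    +-closed = proj₁ (proj₂ subspace)
    *-closed : ∀ c w → K c → P w → P (c * w)
    *-closed = proj₂ (proj₂ subspace)
    neg-closed : ∀ x → P x → P (- x)
    neg-closed x px = subst P (trans (sym (-‿distribˡ-* 1# x)) (cong -_ (*-identityˡ x))) (*-closed (- 1#) x (K-neg 1# K-1#) px)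
    sub-closed : ∀ x y → P x → P y → P (x - y)
    sub-closed x y px py = +-closed x (- y) px (neg-closed y py)

  coordinates-size : ∀ d → HasSize (All K {d}) (q ^ d)
  coordinates-size zero    = size-cong (λ { [] _ → [] }) (λ { [] _ → refl }) (size-singleton [])
  coordinates-size (suc d) = size-image (λ (p : F × Vec F d) → proj₁ p ∷ proj₂ p)
    (λ { (x , c) (y , c') _ _ x∷c≡y∷c' → cong₂ _,_ (VecP.∷-injectiveˡ x∷c≡y∷c') (VecP.∷-injectiveʳ x∷c≡y∷c') })
    (λ { (x , c) (kx , kc) → kx ∷ kc })
    (λ { (x ∷ c) (kx ∷ kc) → (x , c) , (kx , kc) , refl })
    (size-× sizeK (coordinates-size d))

  dimension⇒size : ∀ {W d} → IsSubspace K W → HasDim K W d → HasSize W (q ^ d)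
  dimension⇒size {W} {d} subspace (b , b∈W , spanning , independent) = size-image (λ c → lincomb c b)
    (λ c c' kc kc' cb≡c'b → difference-zero c c' (independent _ (difference-K c c' kc kc')
       (trans (lincomb-difference c c' b) (trans (cong (_- lincomb c' b) cb≡c'b) (-‿inverseʳ _)))))
    (λ c kc → lincomb-closed c b kc b∈W)
    spanning
    (coordinates-size d)
    where
    lincomb-difference : ∀ {m} (c c' b : Vec F m) → lincomb (zipWith _-_ c c') b ≡ lincomb c b - lincomb c' b
    lincomb-difference [] [] [] = sym (-‿inverseʳ 0#)
    lincomb-difference (x ∷ c) (y ∷ c') (β ∷ b) = trans (cong ((x - y) * β +_) (lincomb-difference c c' b))
      (solve 5 (λ x y β L L' → (x :- y) :* β :+ (L :- L') := (x :* β :+ L) :- (y :* β :+ L')) refl x y β (lincomb c b) (lincomb c' b))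
    difference-K : ∀ {m} (c c' : Vec F m) → All K c → All K c' → All K (zipWith _-_ c c')
    difference-K [] [] [] [] = []
    difference-K (x ∷ c) (y ∷ c') (kx ∷ kc) (ky ∷ kc') = K-sub x y kx ky ∷ difference-K c c' kc kc'
    difference-zero : ∀ {m} (c c' : Vec F m) → All (_≡ 0#) (zipWith _-_ c c') → c ≡ c'
    difference-zero [] [] [] = refl
    difference-zero (x ∷ c) (y ∷ c') (x-y≡0 ∷ rest) = cong₂ _∷_ (x-y≡0⇒x≡y x-y≡0) (difference-zero c c' rest)
    open Subspace subspace
    lincomb-closed : ∀ {m} (c b : Vec F m) → All K c → All W b → W (lincomb c b)
    lincomb-closed [] [] [] [] = 0∈
    lincomb-closed (x ∷ c) (β ∷ b) (kx ∷ kc) (wβ ∷ wb) = +-closed _ _ (*-closed x β kx wβ) (lincomb-closed c b kc wb)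

  translate-size : ∀ {P : F → Set} {m} → HasSize P m → ∀ e → HasSize (λ c → P (c - e)) m
  translate-size {P} sP e = size-image (_+ e)
    (λ x y _ _ x+e≡y+e → trans (sym (cancel x)) (trans (cong (_- e) x+e≡y+e) (cancel y)))
    (λ x px → subst P (sym (cancel x)) px)
    (λ c pc → c - e , pc , solve 2 (λ c e → c := (c :- e) :+ e) refl c e)
    sP
    where cancel : ∀ x → (x + e) - e ≡ x
          cancel x = solve 2 (λ x e → (x :+ e) :- e := x) refl x e

  module _ {P : F → Set} (subspace : IsSubspace K P) {e₁ e₂ : F} where
    open Subspace subspace

    cosets-equal : P (e₁ - e₂) → ∀ c → P (c - e₁) → P (c - e₂)
    cosets-equal p c pc = subst P (solve 3 (λ c e₁ e₂ → (c :- e₁) :+ (e₁ :- e₂) := c :- e₂) refl c e₁ e₂) (+-closed _ _ pc p)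

    cosets-meet : ∀ c → P (c - e₁) → P (c - e₂) → P (e₁ - e₂)
    cosets-meet c pc₁ pc₂ =
      subst P (solve 3 (λ c e₁ e₂ → (c :- e₂) :- (c :- e₁) := e₁ :- e₂) refl c e₁ e₂) (sub-closed _ _ pc₂ pc₁)

  module Hyperplanes {Q : ℕ} (n≡Q*q : n ≡ Q ℕ.* q) {P P' : F → Set} (subspaceP : IsSubspace K P) (subspaceP' : IsSubspace K P')
                     (sizeP : HasSize P Q) (sizeP' : HasSize P' Q) {x : F} (P'x : P' x) (¬Px : ¬ P x) where
    private
      module P = Subspace subspaceP
      module P' = Subspace subspaceP'

    combine : F × F → F
    combine (p , l) = p + l * x

    combine-injective : ∀ u v → P (proj₁ u) × K (proj₂ u) → P (proj₁ v) × K (proj₂ v) → combine u ≡ combine v → u ≡ v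
    combine-injective (p , l) (p' , l') (pp , kl) (pp' , kl') p+lx≡p'+l'x with l ≟ l'
    ... | yes refl = cong (_, l) (trans (sym (cancel p)) (trans (cong (_- l * x) p+lx≡p'+l'x) (cancel p')))
      where cancel : ∀ y → (y + l * x) - l * x ≡ y
            cancel y = solve 2 (λ y z → (y :+ z) :- z := y) refl y (l * x)
    ... | no l≢l' = ⊥-elim (¬Px (subst P x≡ (P.*-closed _ _ (K-⁻¹ δ (K-sub l l' kl kl') δ≢0) (P.sub-closed p' p pp' pp))))
      where
      δ = l - l'
      δ≢0 : δ ≢ 0#
      δ≢0 δ≡0 = l≢l' (x-y≡0⇒x≡y δ≡0)
      δx≡p'-p : δ * x ≡ p' - p
      δx≡p'-p = begin
        δ * x                          ≡⟨ solve 4 (λ l l' x p → (l :- l') :* x := ((p :+ l :* x) :- p) :- l' :* x) refl l l' x p ⟩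
        ((p + l * x) - p) - l' * x     ≡⟨ cong (λ u → (u - p) - l' * x) p+lx≡p'+l'x ⟩
        ((p' + l' * x) - p) - l' * x   ≡⟨ solve 4 (λ l' x p p' → ((p' :+ l' :* x) :- p) :- l' :* x := p' :- p) refl l' x p p' ⟩
        p' - p                         ∎
      x≡ : δ ⁻¹ * (p' - p) ≡ x
      x≡ = begin
        δ ⁻¹ * (p' - p)   ≡⟨ cong (δ ⁻¹ *_) (sym δx≡p'-p) ⟩
        δ ⁻¹ * (δ * x)    ≡⟨ sym (*-assoc _ _ _) ⟩
        δ ⁻¹ * δ * x      ≡⟨ cong (_* x) (⁻¹-inverseˡ δ δ≢0) ⟩
        1# * x            ≡⟨ *-identityˡ x ⟩
        x                 ∎

    -- P ⊕ K x has Q q = |F| elements, so it is all of F.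
    decompose : ∀ z → Σ (F × F) λ u → (P (proj₁ u) × K (proj₂ u)) × z ≡ combine u
    decompose z = size-⊆-full _≟_ (λ _ _ → tt) image (subst (HasSize _) n≡Q*q finite) z tt
      where
      image : HasSize (λ z → Σ (F × F) λ u → (P (proj₁ u) × K (proj₂ u)) × z ≡ combine u) (Q ℕ.* q)
      image = size-image combine combine-injective (λ u pu → u , pu , refl) (λ _ p → p) (size-× sizeP sizeK)

    intersection-size : ∀ {m} → m ℕ.* q ≡ Q → HasSize (λ z → P z × P' z) m
    intersection-size {m} m*q≡Q with size-split sizeP (size⇒dec _≟_ sizeP')
    ... | a , _ , sa , _ , _ = subst (HasSize _) a≡m sa
      where
      q-nonZero : NonZero q
      q-nonZero = ℕ.>-nonZero (size-≤ (λ { _ refl → K-0# }) (size-singleton 0#) sizeK)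
      remove : ∀ y p l → y ≡ p + l * x → y - l * x ≡ p
      remove y p l y≡ = trans (cong (_- l * x) y≡) (solve 2 (λ p z → (p :+ z) :- z := p) refl p (l * x))
      P'-size : HasSize P' (a ℕ.* q)
      P'-size = size-image combine (λ u v (iu , ku) (iv , kv) → combine-injective u v (proj₁ iu , ku) (proj₁ iv , kv))
        (λ (s , l) ((_ , p's) , kl) → P'.+-closed _ _ p's (P'.*-closed l x kl P'x))
        (λ y p'y → let ((p , l) , (pp , kl) , y≡) = decompose y in
           (p , l) , ((pp , subst P' (remove y p l y≡) (P'.sub-closed y (l * x) p'y (P'.*-closed l x kl P'x))) , kl) , y≡)
        (size-× sa sizeK)
      a≡m : a ≡ m
      a≡m = ℕP.*-cancelʳ-≡ a m q ⦃ q-nonZero ⦄ (trans (size-unique P'-size sizeP') (sym m*q≡Q))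

    coset-intersection-size : ∀ {m} → m ℕ.* q ≡ Q → ∀ e₁ e₂ → HasSize (λ c → P (c - e₁) × P' (c - e₂)) m
    coset-intersection-size m*q≡Q e₁ e₂ with decompose (e₂ - e₁)
    ... | (p₀ , l₀) , (pp₀ , kl₀) , e₂-e₁≡ = size-image (c₀ +_)
      (λ u v _ _ c₀+u≡c₀+v → trans (sym (cancel u)) (trans (cong (_- c₀) c₀+u≡c₀+v) (cancel v)))
      (λ s (ps , p's) → subst P (sym (shift₁ s)) (P.+-closed _ _ pp₀ ps) ,
                         subst P' (sym (shift₂ s)) (P'.sub-closed s (l₀ * x) p's lx∈P'))
      (λ c (pc , p'c) → c - c₀ , (subst P (sym (unshift₁ c)) (P.sub-closed _ _ pc pp₀) ,
                                  subst P' (sym (unshift₂ c)) (P'.+-closed _ _ p'c lx∈P')) ,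
                        solve 2 (λ c c₀ → c := c₀ :+ (c :- c₀)) refl c c₀)
      (intersection-size m*q≡Q)
      where
      c₀ = e₁ + p₀
      lx∈P' : P' (l₀ * x)
      lx∈P' = P'.*-closed l₀ x kl₀ P'x
      cancel : ∀ u → (c₀ + u) - c₀ ≡ u
      cancel u = solve 2 (λ c₀ u → (c₀ :+ u) :- c₀ := u) refl c₀ u
      e₂-c₀≡lx : e₂ - c₀ ≡ l₀ * x
      e₂-c₀≡lx = begin
        e₂ - (e₁ + p₀)          ≡⟨ solve 3 (λ e₁ e₂ p₀ → e₂ :- (e₁ :+ p₀) := (e₂ :- e₁) :- p₀) refl e₁ e₂ p₀ ⟩
        (e₂ - e₁) - p₀          ≡⟨ cong (_- p₀) e₂-e₁≡ ⟩
        (p₀ + l₀ * x) - p₀      ≡⟨ solve 2 (λ p₀ z → (p₀ :+ z) :- p₀ := z) refl p₀ (l₀ * x) ⟩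
        l₀ * x                  ∎
      shift₁ : ∀ s → (c₀ + s) - e₁ ≡ p₀ + s
      shift₁ s = solve 3 (λ e₁ p₀ s → ((e₁ :+ p₀) :+ s) :- e₁ := p₀ :+ s) refl e₁ p₀ s
      shift₂ : ∀ s → (c₀ + s) - e₂ ≡ s - l₀ * x
      shift₂ s = trans (solve 3 (λ c₀ s e₂ → (c₀ :+ s) :- e₂ := s :- (e₂ :- c₀)) refl c₀ s e₂) (cong (λ z → s - z) e₂-c₀≡lx)
      unshift₁ : ∀ c → c - c₀ ≡ (c - e₁) - p₀
      unshift₁ c = solve 3 (λ c e₁ p₀ → c :- (e₁ :+ p₀) := (c :- e₁) :- p₀) refl c e₁ p₀
      unshift₂ : ∀ c → c - c₀ ≡ (c - e₂) + l₀ * x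
      unshift₂ c = trans (solve 3 (λ c c₀ e₂ → c :- c₀ := (c :- e₂) :+ (e₂ :- c₀)) refl c c₀ e₂) (cong ((c - e₂) +_) e₂-c₀≡lx)

module Construction (𝔽 : Field) (q r t : ℕ) (prime-power : IsPrimePower q) (1<r : 1 < r)
  (sizeF : HasSize (λ (_ : Field.Carrier 𝔽) → ⊤) (q ^ r))
  (K : Field.Carrier 𝔽 → Set) (subfield : FieldTheory.IsSubfield 𝔽 K) (sizeK : HasSize K q)
  (τ : Field.Carrier 𝔽) (τ-primitive : FieldTheory.IsPrimitive 𝔽 τ)
  (θ : Field.Carrier 𝔽) (θ≡τ^[q-1] : θ ≡ Field._^ᶠ_ 𝔽 τ (q ∸ 1))
  (t*[q-1]≡q^r-1 : t ℕ.* (q ∸ 1) ≡ q ^ r ∸ 1)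
  (W : Field.Carrier 𝔽 → Set) (subspaceW : FieldTheory.IsSubspace 𝔽 K W) (dimW : FieldTheory.HasDim 𝔽 K W (r ∸ 1))
  (φ : Permutation′ t)
  (symmetric : ∀ (i : Fin t) (β : Field.Carrier 𝔽) →
     (Σ _ λ α → FieldTheory.ψM 𝔽 W τ (toℕ (φ ⟨$⟩ʳ i)) α × β ≡ Field._*_ 𝔽 α (Field._^ᶠ_ 𝔽 θ (toℕ i)))
     ⇔ FieldTheory.ψM 𝔽 W τ (toℕ (φ ⟨$⟩ʳ negF i)) β)
  where
  open import Data.Nat as ℕ using (ℕ; zero; suc; _<_; _≤_; _∸_; _^_; z≤n; s≤s; NonZero)
  import Data.Nat.Properties as ℕP
  open import Data.Nat.DivMod using (m%n<n)
  open import Data.Nat.Divisibility using (_∣_; quotient; *-cancelʳ-∣; ∣⇒≤)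
  open import Data.Fin as Fin using (Fin; toℕ; fromℕ<)
  import Data.Fin.Properties as FinP
  open import Data.Fin.Permutation using (Permutation′; _⟨$⟩ʳ_; _⟨$⟩ˡ_; inverseˡ)
  open import Data.Product using (Σ; _×_; _,_; proj₁; proj₂)
  open import Data.Product.Properties using (≡-dec)
  open import Data.Sum using (inj₁; inj₂)
  open import Data.Empty using (⊥-elim)
  open import Data.Unit using (⊤; tt)
  open import Function.Bundles using (_⇔_; mk⇔; Equivalence)
  open import Relation.Binary using (tri<; tri≈; tri>)
  open import Relation.Binary.PropositionalEquality
  open import Relation.Nullary using (¬_; Dec; yes; no)
  open FiniteField 𝔽 sizeF
  open FiniteSubfield 𝔽 sizeF K subfield sizeK
  open ≡-Reasoning

  2≤q : 2 ≤ q
  2≤q = prime-power⇒2≤ prime-power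

  q₁ : ℕ
  q₁ = q ∸ 1

  q≡1+q₁ : q ≡ suc q₁
  q≡1+q₁ = sym (ℕP.m+[n∸m]≡n (ℕP.≤-trans (s≤s z≤n) 2≤q))

  instance
    q₁-nonZero : NonZero q₁
    q₁-nonZero = ℕ.>-nonZero (ℕP.≤-pred (subst (2 ≤_) q≡1+q₁ 2≤q))

  Q : ℕ
  Q = q ^ (r ∸ 1)

  X : ℕ
  X = q ^ (r ∸ 2)

  q^r≡q*Q : q ^ r ≡ q ℕ.* Q
  q^r≡q*Q = cong (q ^_) (sym (ℕP.m+[n∸m]≡n (ℕP.<⇒≤ 1<r)))

  X*q≡Q : X ℕ.* q ≡ Q
  X*q≡Q = trans (ℕP.*-comm X q) (cong (q ^_) (sym (ℕP.+-∸-assoc 1 1<r)))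

  N : ℕ
  N = q ^ r ∸ 1

  N≡t*q₁ : N ≡ t ℕ.* q₁
  N≡t*q₁ = sym t*[q-1]≡q^r-1

  4≤q^r : 4 ≤ q ^ r
  4≤q^r = subst (4 ≤_) (sym (trans q^r≡q*Q (cong (q ℕ.*_) (sym X*q≡Q))))
    (ℕP.*-mono-≤ 2≤q (ℕP.*-mono-≤ (ℕP.m^n>0 q ⦃ ℕ.>-nonZero (ℕP.≤-trans (s≤s z≤n) 2≤q) ⦄ (r ∸ 2)) 2≤q))

  q^r≡1+N : q ^ r ≡ suc N
  q^r≡1+N = sym (ℕP.m+[n∸m]≡n (ℕP.≤-trans (s≤s z≤n) 4≤q^r))

  3≤N : 3 ≤ N
  3≤N = ℕP.≤-pred (subst (4 ≤_) q^r≡1+N 4≤q^r)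

  instance
    N-nonZero : NonZero N
    N-nonZero = ℕ.>-nonZero (ℕP.≤-trans (s≤s z≤n) 3≤N)

    t-nonZero : NonZero t
    t-nonZero = ℕP.m*n≢0⇒m≢0 t ⦃ subst NonZero N≡t*q₁ N-nonZero ⦄

  nonzero-size : HasSize (_≢ 0#) N
  nonzero-size = size-cong (λ _ → proj₂) (λ _ x≢0 → tt , x≢0) (size-remove _≟_ {x = 0#} (subst (HasSize _) q^r≡1+N sizeF) tt)

  τ≢0 : τ ≢ 0#
  τ≢0 τ≡0 = ℕP.<⇒≱ (ℕP.≤-trans (s≤s (s≤s z≤n)) 3≤N) (size-≤ nonzero⇒1 nonzero-size (size-singleton 1#))
    where
    nonzero⇒1 : ∀ x → x ≢ 0# → x ≡ 1#
    nonzero⇒1 x x≢0 with τ-primitive x x≢0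
    ... | zero  , x≡1    = x≡1
    ... | suc j , x≡τ^1+j = ⊥-elim (x≢0 (trans x≡τ^1+j (trans (cong (_* τ ^ᶠ j) τ≡0) (zeroˡ _))))

  order≡N : ∀ {o} → IsOrder τ o → o ≡ N
  order≡N {o} order = size-unique powers nonzero-size
    where
    instance
      o-nonZero : NonZero o
      o-nonZero = ℕ.>-nonZero (proj₁ order)
    open Order τ≢0 order
    powers : HasSize (_≢ 0#) o
    powers = size-image (λ (i : Fin o) → τ ^ᶠ toℕ i) {P = λ _ → ⊤} {Q = _≢ 0#}
      (λ i j _ _ τⁱ≡τʲ → FinP.toℕ-injective (^-injective _ _ (FinP.toℕ<n i) (FinP.toℕ<n j) τⁱ≡τʲ))
      (λ i _ → ^-nonzero (toℕ i) τ≢0)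
      (λ x x≢0 → let (j , x≡τʲ) = τ-primitive x x≢0 ; j%o<o = m%n<n j o in
        fromℕ< j%o<o , tt , trans x≡τʲ (trans (^-% j) (cong (τ ^ᶠ_) (sym (FinP.toℕ-fromℕ< j%o<o)))))
      (size-Fin o)

  τ-order : IsOrder τ N
  τ-order = subst (IsOrder τ) (order≡N (proj₂ (order-exists τ≢0))) (proj₂ (order-exists τ≢0))

  module τ-order = Order τ≢0 τ-order

  opaque
    log : ∀ x → x ≢ 0# → Σ ℕ λ j → j < N × x ≡ τ ^ᶠ j
    log x x≢0 = let (j , x≡τʲ) = τ-primitive x x≢0 in j ℕ.% N , m%n<n j N , trans x≡τʲ (τ-order.^-% j)

  ^N≡1 : ∀ {x} → x ≢ 0# → x ^ᶠ N ≡ 1#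
  ^N≡1 x≢0 = closed⇒^size≡1 (_≢ 0#) x≢0 (λ _ y≢0 → y≢0) (λ y y≢0 → *-nonzero y≢0 x≢0) nonzero-size

  θ^≡τ^ : ∀ a → θ ^ᶠ a ≡ τ ^ᶠ (q₁ ℕ.* a)
  θ^≡τ^ a = trans (cong (_^ᶠ a) θ≡τ^[q-1]) (^-*-assoc τ q₁ a)

  θ≢0 : θ ≢ 0#
  θ≢0 = subst (_≢ 0#) (sym θ≡τ^[q-1]) (^-nonzero q₁ τ≢0)

  θ^t≡1 : θ ^ᶠ t ≡ 1#
  θ^t≡1 = trans (θ^≡τ^ t) (trans (cong (τ ^ᶠ_) (trans (ℕP.*-comm q₁ t) (sym N≡t*q₁))) τ-order.gᵒ≡1)

  q₁*k<N : ∀ {k} → k < t → q₁ ℕ.* k < N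
  q₁*k<N {k} k<t = subst (q₁ ℕ.* k <_) (trans (ℕP.*-comm q₁ t) (sym N≡t*q₁)) (ℕP.*-monoʳ-< q₁ k<t)

  θ-order : IsOrder θ t
  θ-order = ℕ.>-nonZero⁻¹ t , θ^t≡1 , λ k 0<k k<t θᵏ≡1 →
    ℕP.<⇒≱ (q₁*k<N k<t) (∣⇒≤ ⦃ ℕP.m*n≢0 q₁ k ⦃ q₁-nonZero ⦄ ⦃ ℕ.>-nonZero 0<k ⦄ ⦄ (τ-order.^≡1⇒∣ (q₁ ℕ.* k) (trans (sym (θ^≡τ^ k)) θᵏ≡1)))

  module θ-order = Order θ≢0 θ-order

  θ^ : Fin t → F
  θ^ i = θ ^ᶠ toℕ i

  θ^-nonzero : ∀ i → θ^ i ≢ 0#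
  θ^-nonzero i = ^-nonzero (toℕ i) θ≢0

  θ^-injective : ∀ {i j} → θ^ i ≡ θ^ j → i ≡ j
  θ^-injective {i} {j} θⁱ≡θʲ = FinP.toℕ-injective (θ-order.^-injective _ _ (FinP.toℕ<n i) (FinP.toℕ<n j) θⁱ≡θʲ)

  θ^-negF : ∀ i → θ^ (negF i) * θ^ i ≡ 1#
  θ^-negF i with negF-+ i
  ... | inj₁ (i≡0 , negFi≡0) = trans (cong₂ (λ a b → θ ^ᶠ a * θ ^ᶠ b) negFi≡0 i≡0) (*-identityˡ 1#)
  ... | inj₂ sum≡t = trans (sym (^-distribˡ-+-* θ (toℕ (negF i)) (toℕ i))) (trans (cong (θ ^ᶠ_) sum≡t) θ^t≡1)

  infixl 6 _⊖_
  _⊖_ : Fin t → Fin t → Fin t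
  u ⊖ j = fromℕ< (m%n<n (toℕ u ℕ.+ (t ∸ toℕ j)) t)

  θ^-⊖ : ∀ u j → θ^ (u ⊖ j) * θ^ j ≡ θ^ u
  θ^-⊖ u j = begin
    θ ^ᶠ toℕ (u ⊖ j) * θ^ j                 ≡⟨ cong (λ e → θ ^ᶠ e * θ^ j) (FinP.toℕ-fromℕ< (m%n<n e t)) ⟩
    θ ^ᶠ (e ℕ.% t) * θ^ j                   ≡⟨ cong (_* θ^ j) (sym (θ-order.^-% e)) ⟩
    θ ^ᶠ (toℕ u ℕ.+ (t ∸ toℕ j)) * θ^ j     ≡⟨ cong (_* θ^ j) (^-distribˡ-+-* θ (toℕ u) (t ∸ toℕ j)) ⟩
    θ^ u * θ ^ᶠ (t ∸ toℕ j) * θ^ j          ≡⟨ *-assoc _ _ _ ⟩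
    θ^ u * (θ ^ᶠ (t ∸ toℕ j) * θ^ j)        ≡⟨ cong (θ^ u *_) (sym (^-distribˡ-+-* θ (t ∸ toℕ j) (toℕ j))) ⟩
    θ^ u * θ ^ᶠ (t ∸ toℕ j ℕ.+ toℕ j)       ≡⟨ cong (λ e → θ^ u * θ ^ᶠ e) (ℕP.m∸n+n≡m (ℕP.<⇒≤ (FinP.toℕ<n j))) ⟩
    θ^ u * θ ^ᶠ t                           ≡⟨ cong (θ^ u *_) θ^t≡1 ⟩
    θ^ u * 1#                               ≡⟨ *-identityʳ _ ⟩
    θ^ u                                    ∎
    where e = toℕ u ℕ.+ (t ∸ toℕ j)

  ⊖-injectiveˡ : ∀ {u v} j → u ⊖ j ≡ v ⊖ j → u ≡ v
  ⊖-injectiveˡ {u} {v} j u⊖j≡v⊖j = θ^-injective (begin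
    θ^ u                ≡⟨ sym (θ^-⊖ u j) ⟩
    θ^ (u ⊖ j) * θ^ j   ≡⟨ cong (λ i → θ^ i * θ^ j) u⊖j≡v⊖j ⟩
    θ^ (v ⊖ j) * θ^ j   ≡⟨ θ^-⊖ v j ⟩
    θ^ v                ∎)

  ⊖-injectiveʳ : ∀ u {j j'} → u ⊖ j ≡ u ⊖ j' → j ≡ j'
  ⊖-injectiveʳ u {j} {j'} u⊖j≡u⊖j' = θ^-injective (*-cancelˡ (θ^-nonzero (u ⊖ j)) (begin
    θ^ (u ⊖ j) * θ^ j     ≡⟨ θ^-⊖ u j ⟩
    θ^ u                  ≡⟨ sym (θ^-⊖ u j') ⟩
    θ^ (u ⊖ j') * θ^ j'   ≡⟨ cong (λ i → θ^ i * θ^ j') (sym u⊖j≡u⊖j') ⟩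
    θ^ (u ⊖ j) * θ^ j'    ∎))

  private
    θ-log-pick : ∀ y → Dec (Σ (Fin t) λ j → θ^ j ≡ y) → Fin t
    θ-log-pick y (yes (j , _)) = j
    θ-log-pick y (no _)        = fromℕ< (ℕ.>-nonZero⁻¹ t)

  θ-log : F → Fin t
  θ-log y = θ-log-pick y (FinP.any? (λ j → θ^ j ≟ y))

  θ-log-θ^ : ∀ j → θ-log (θ^ j) ≡ j
  θ-log-θ^ j = pick-θ^ (FinP.any? (λ i → θ^ i ≟ θ^ j))
    where
    pick-θ^ : ∀ d → θ-log-pick (θ^ j) d ≡ j
    pick-θ^ (yes (i , θⁱ≡θʲ)) = θ^-injective θⁱ≡θʲ
    pick-θ^ (no none)         = ⊥-elim (none (j , refl))

  K*-size : HasSize (λ x → K x × x ≢ 0#) q₁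
  K*-size = size-remove _≟_ {x = 0#} (subst (HasSize K) q≡1+q₁ sizeK) K-0#

  K*⇒^q₁≡1 : ∀ {x} → K x → x ≢ 0# → x ^ᶠ q₁ ≡ 1#
  K*⇒^q₁≡1 {x} kx x≢0 =
    closed⇒^size≡1 (λ y → K y × y ≢ 0#) x≢0 (λ _ → proj₂) (λ y (ky , y≢0) → K-* _ _ ky kx , *-nonzero y≢0 x≢0) K*-size

  RootOfUnity : F → Set
  RootOfUnity y = Σ (Fin q₁) λ m → y ≡ τ ^ᶠ (t ℕ.* toℕ m)

  roots-size : HasSize RootOfUnity q₁
  roots-size = size-image (λ (m : Fin q₁) → τ ^ᶠ (t ℕ.* toℕ m)) {P = λ _ → ⊤}
    (λ i j _ _ τ^ti≡τ^tj → FinP.toℕ-injective (ℕP.*-cancelˡ-≡ _ _ t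
      (τ-order.^-injective _ _ (t*m<N (FinP.toℕ<n i)) (t*m<N (FinP.toℕ<n j)) τ^ti≡τ^tj)))
    (λ m _ → m , refl) (λ y (m , y≡) → m , tt , y≡) (size-Fin q₁)
    where
    t*m<N : ∀ {m} → m < q₁ → t ℕ.* m < N
    t*m<N {m} m<q₁ = subst (t ℕ.* m <_) (sym N≡t*q₁) (ℕP.*-monoʳ-< t m<q₁)

  K*⊆roots : ∀ {x} → K x → x ≢ 0# → RootOfUnity x
  K*⊆roots {x} kx x≢0 with log x x≢0
  ... | j , j<N , x≡τʲ = fromℕ< m<q₁ , trans x≡τʲ (cong (τ ^ᶠ_) (trans j≡t*m (cong (t ℕ.*_) (sym (FinP.toℕ-fromℕ< m<q₁)))))
    where
    N∣j*q₁ : N ∣ j ℕ.* q₁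
    N∣j*q₁ = τ-order.^≡1⇒∣ _ (trans (sym (^-*-assoc τ j q₁)) (trans (cong (_^ᶠ q₁) (sym x≡τʲ)) (K*⇒^q₁≡1 kx x≢0)))
    t∣j : t ∣ j
    t∣j = *-cancelʳ-∣ q₁ (subst (_∣ j ℕ.* q₁) N≡t*q₁ N∣j*q₁)
    m = quotient t∣j
    j≡t*m : j ≡ t ℕ.* m
    j≡t*m = trans (_∣_.equality t∣j) (ℕP.*-comm m t)
    m<q₁ : m < q₁
    m<q₁ = ℕP.*-cancelˡ-< t m q₁ (subst (_< t ℕ.* q₁) j≡t*m (subst (j <_) N≡t*q₁ j<N))

  τ^t∈K : K (τ ^ᶠ t)
  τ^t∈K with 1 ℕ.<? q₁
  ... | yes 1<q₁ = proj₁ (size-⊆-full _≟_ (λ x (kx , x≢0) → K*⊆roots kx x≢0) K*-size roots-size (τ ^ᶠ t)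
                            (fromℕ< 1<q₁ , cong (τ ^ᶠ_) (trans (sym (ℕP.*-identityʳ t)) (cong (t ℕ.*_) (sym (FinP.toℕ-fromℕ< 1<q₁))))))
  ... | no 1≮q₁ = subst K (sym τ^t≡1) K-1#
    where
    q₁≡1 : q₁ ≡ 1
    q₁≡1 = ℕP.≤-antisym (ℕP.≮⇒≥ 1≮q₁) (ℕ.>-nonZero⁻¹ q₁)
    τ^t≡1 : τ ^ᶠ t ≡ 1#
    τ^t≡1 = trans (cong (τ ^ᶠ_) (trans (sym (ℕP.*-identityʳ t)) (trans (cong (t ℕ.*_) (sym q₁≡1)) (sym N≡t*q₁)))) τ-order.gᵒ≡1

  Q₀ : ℕ
  Q₀ = Q ∸ 1

  Q≡1+Q₀ : Q ≡ suc Q₀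
  Q≡1+Q₀ = sym (ℕP.m+[n∸m]≡n (ℕP.m^n>0 q ⦃ ℕ.>-nonZero (ℕP.≤-trans (s≤s z≤n) 2≤q) ⦄ (r ∸ 1)))

  N≡q₁+q*Q₀ : N ≡ q₁ ℕ.+ q ℕ.* Q₀
  N≡q₁+q*Q₀ = ℕP.suc-injective (begin
    suc N                   ≡⟨ sym q^r≡1+N ⟩
    q ^ r                   ≡⟨ q^r≡q*Q ⟩
    q ℕ.* Q                 ≡⟨ cong (q ℕ.*_) Q≡1+Q₀ ⟩
    q ℕ.* suc Q₀            ≡⟨ ℕP.*-suc q Q₀ ⟩
    q ℕ.+ q ℕ.* Q₀          ≡⟨ cong (ℕ._+ q ℕ.* Q₀) q≡1+q₁ ⟩
    suc (q₁ ℕ.+ q ℕ.* Q₀)   ∎)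

  W-size : HasSize W Q
  W-size = dimension⇒size subspaceW dimW

  W*-size : HasSize (λ w → W w × w ≢ 0#) Q₀
  W*-size = size-remove _≟_ {x = 0#} (subst (HasSize W) Q≡1+Q₀ W-size) (Subspace.0∈ subspaceW)

  -- g^Q₀ = 1 by the orbit argument on W ∖ {0}, and g^N = 1 where N = q₁ + q Q₀.
  W-multiplier⇒^q₁≡1 : ∀ {g} → g ≢ 0# → (∀ w → W w → W (w * g)) → g ^ᶠ q₁ ≡ 1#
  W-multiplier⇒^q₁≡1 {g} g≢0 closed = begin
    g ^ᶠ q₁                         ≡⟨ sym (*-identityʳ _) ⟩
    g ^ᶠ q₁ * 1#                    ≡⟨ cong (g ^ᶠ q₁ *_) (sym (1^n≡1 q)) ⟩
    g ^ᶠ q₁ * 1# ^ᶠ q               ≡⟨ cong (λ x → g ^ᶠ q₁ * x ^ᶠ q) (sym g^Q₀≡1) ⟩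
    g ^ᶠ q₁ * (g ^ᶠ Q₀) ^ᶠ q        ≡⟨ cong (g ^ᶠ q₁ *_) (trans (^-*-assoc g Q₀ q) (cong (g ^ᶠ_) (ℕP.*-comm Q₀ q))) ⟩
    g ^ᶠ q₁ * g ^ᶠ (q ℕ.* Q₀)       ≡⟨ sym (^-distribˡ-+-* g q₁ (q ℕ.* Q₀)) ⟩
    g ^ᶠ (q₁ ℕ.+ q ℕ.* Q₀)          ≡⟨ cong (g ^ᶠ_) (sym N≡q₁+q*Q₀) ⟩
    g ^ᶠ N                          ≡⟨ ^N≡1 g≢0 ⟩
    1#                              ∎
    where
    g^Q₀≡1 : g ^ᶠ Q₀ ≡ 1#
    g^Q₀≡1 = closed⇒^size≡1 (λ w → W w × w ≢ 0#) g≢0 (λ _ → proj₂) (λ w (ww , w≢0) → closed w ww , *-nonzero w≢0 g≢0) W*-size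

  M : ℕ → F → Set
  M k = ψM W τ k

  M-subspace : ∀ k → IsSubspace K (M k)
  M-subspace k =
    (0# , 0∈ , sym (zeroˡ _)) ,
    (λ { _ _ (w , ww , refl) (w' , ww' , refl) → w + w' , +-closed _ _ ww ww' , sym (distribʳ _ _ _) }) ,
    (λ { c _ kc (w , ww , refl) → c * w , *-closed c w kc ww , sym (*-assoc _ _ _) })
    where open Subspace subspaceW

  M-size : ∀ k → HasSize (M k) Q
  M-size k = size-image (_* τ ^ᶠ k) (λ _ _ _ _ → *-cancelʳ (^-nonzero k τ≢0)) (λ w ww → w , ww , refl) (λ _ m → m) W-size

  M-⊈ : ∀ {k l} → k < l → l < t → ¬ (∀ z → M l z → M k z)
  M-⊈ {k} {l} k<l l<t M_l⊆M_k = ℕP.<⇒≱ s<t (∣⇒≤ ⦃ ℕ.>-nonZero (ℕP.m<n⇒0<n∸m k<l) ⦄ t∣s)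
    where
    s = l ∸ k
    s<t : s < t
    s<t = ℕP.≤-<-trans (ℕP.m∸n≤m l k) l<t
    τ^s-closed : ∀ w → W w → W (w * τ ^ᶠ s)
    τ^s-closed w ww with M_l⊆M_k (w * τ ^ᶠ l) (w , ww , refl)
    ... | w' , ww' , wτˡ≡w'τᵏ = subst W (*-cancelʳ (^-nonzero k τ≢0) (begin
      w' * τ ^ᶠ k                 ≡⟨ sym wτˡ≡w'τᵏ ⟩
      w * τ ^ᶠ l                  ≡⟨ cong (λ e → w * τ ^ᶠ e) (sym (ℕP.m∸n+n≡m (ℕP.<⇒≤ k<l))) ⟩
      w * τ ^ᶠ (s ℕ.+ k)          ≡⟨ cong (w *_) (^-distribˡ-+-* τ s k) ⟩
      w * (τ ^ᶠ s * τ ^ᶠ k)       ≡⟨ sym (*-assoc _ _ _) ⟩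
      w * τ ^ᶠ s * τ ^ᶠ k         ∎)) ww'
    N∣s*q₁ : N ∣ s ℕ.* q₁
    N∣s*q₁ = τ-order.^≡1⇒∣ (s ℕ.* q₁) (trans (sym (^-*-assoc τ s q₁)) (W-multiplier⇒^q₁≡1 (^-nonzero s τ≢0) τ^s-closed))
    t∣s : t ∣ s
    t∣s = *-cancelʳ-∣ q₁ (subst (_∣ s ℕ.* q₁) N≡t*q₁ N∣s*q₁)

  M-distinct : ∀ {k l} → k < t → l < t → k ≢ l → ¬ (∀ z → M l z → M k z)
  M-distinct {k} {l} k<t l<t k≢l M_l⊆M_k with ℕP.<-cmp k l
  ... | tri< k<l _ _ = M-⊈ k<l l<t M_l⊆M_k
  ... | tri≈ _ k≡l _ = k≢l k≡l
  ... | tri> _ _ l<k = M-⊈ l<k k<t (size-⊆-full _≟_ M_l⊆M_k (M-size l) (M-size k))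

  Scaling : F → F → Set
  Scaling d y = y ≢ 0# × Σ F λ w → W w × d ≡ w * y

  scalings-size-via-W : ∀ {d} → d ≢ 0# → HasSize (Scaling d) Q₀
  scalings-size-via-W {d} d≢0 = size-image (λ w → w ⁻¹ * d)
    (λ w w' (_ , w≢0) (_ , w'≢0) w⁻¹d≡w'⁻¹d →
       trans (sym (⁻¹-involutive w≢0)) (trans (cong _⁻¹ (*-cancelʳ d≢0 w⁻¹d≡w'⁻¹d)) (⁻¹-involutive w'≢0)))
    (λ w (ww , w≢0) → *-nonzero (⁻¹-nonzero w≢0) d≢0 , w , ww , sym (*[⁻¹*]-cancel d w≢0))
    (λ y (y≢0 , w , ww , d≡wy) → let w≢0 = λ w≡0 → d≢0 (trans d≡wy (trans (cong (_* y) w≡0) (zeroˡ y))) in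
       w , (ww , w≢0) , sym (trans (cong (w ⁻¹ *_) d≡wy) (⁻¹*[*]-cancel y w≢0)))
    W*-size

  power : Fin q₁ × Fin t → F
  power (m , k) = τ ^ᶠ toℕ (Fin.combine m k)

  power≡ : ∀ m k → power (m , k) ≡ (τ ^ᶠ t) ^ᶠ toℕ m * τ ^ᶠ toℕ k
  power≡ m k = begin
    τ ^ᶠ toℕ (Fin.combine m k)          ≡⟨ cong (τ ^ᶠ_) (FinP.toℕ-combine m k) ⟩
    τ ^ᶠ (t ℕ.* toℕ m ℕ.+ toℕ k)        ≡⟨ ^-distribˡ-+-* τ (t ℕ.* toℕ m) (toℕ k) ⟩
    τ ^ᶠ (t ℕ.* toℕ m) * τ ^ᶠ toℕ k     ≡⟨ cong (_* τ ^ᶠ toℕ k) (sym (^-*-assoc τ t (toℕ m))) ⟩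
    (τ ^ᶠ t) ^ᶠ toℕ m * τ ^ᶠ toℕ k      ∎

  power-injective : ∀ p p' → power p ≡ power p' → p ≡ p'
  power-injective (m , k) (m' , k') power≡power′ =
    let (m≡m' , k≡k') = FinP.combine-injective m k m' k'
                          (FinP.toℕ-injective (τ-order.^-injective _ _ (exponent-< m k) (exponent-< m' k') power≡power′))
    in cong₂ _,_ m≡m' k≡k'
    where
    exponent-< : ∀ m k → toℕ (Fin.combine m k) < N
    exponent-< m k = subst (toℕ (Fin.combine m k) <_) (trans (ℕP.*-comm q₁ t) (sym N≡t*q₁)) (FinP.toℕ<n (Fin.combine m k))

  power-surjective : ∀ y → y ≢ 0# → Σ (Fin q₁ × Fin t) λ p → y ≡ power p
  power-surjective y y≢0 with log y y≢0
  ... | j , j<N , y≡τʲ with FinP.combine-surjective (fromℕ< j<q₁*t)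
    where j<q₁*t = subst (j <_) (trans N≡t*q₁ (ℕP.*-comm t q₁)) j<N
  ... | m , k , combine≡ = (m , k) , trans y≡τʲ (cong (τ ^ᶠ_) (sym (trans (cong toℕ combine≡) (FinP.toℕ-fromℕ< _))))

  -- (τ^t)^m is an invertible scalar in K.
  M⇔scaling : ∀ {d} m k → M (toℕ k) d ⇔ (Σ F λ w → W w × d ≡ w * power (m , k))
  M⇔scaling {d} m k = mk⇔
    (λ (w , ww , d≡wτᵏ) → κ ⁻¹ * w , Subspace.*-closed subspaceW _ w (K-⁻¹ κ Kκ κ≢0) ww , (begin
      d                                  ≡⟨ d≡wτᵏ ⟩
      w * τ ^ᶠ toℕ k                     ≡⟨ cong (_* τ ^ᶠ toℕ k) (sym (*[⁻¹*]-cancel w κ≢0)) ⟩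
      κ * (κ ⁻¹ * w) * τ ^ᶠ toℕ k        ≡⟨ solve 3 (λ κ w′ τᵏ → κ :* w′ :* τᵏ := w′ :* (κ :* τᵏ)) refl κ (κ ⁻¹ * w) (τ ^ᶠ toℕ k) ⟩
      κ ⁻¹ * w * (κ * τ ^ᶠ toℕ k)        ≡⟨ cong (κ ⁻¹ * w *_) (sym (power≡ m k)) ⟩
      κ ⁻¹ * w * power (m , k)           ∎))
    (λ (w , ww , d≡w*power) → κ * w , Subspace.*-closed subspaceW κ w Kκ ww , (begin
      d                          ≡⟨ d≡w*power ⟩
      w * power (m , k)          ≡⟨ cong (w *_) (power≡ m k) ⟩
      w * (κ * τ ^ᶠ toℕ k)       ≡⟨ solve 3 (λ w κ τᵏ → w :* (κ :* τᵏ) := κ :* w :* τᵏ) refl w κ (τ ^ᶠ toℕ k) ⟩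
      κ * w * τ ^ᶠ toℕ k         ∎))
    where
    κ = (τ ^ᶠ t) ^ᶠ toℕ m
    κ≢0 : κ ≢ 0#
    κ≢0 = ^-nonzero (toℕ m) (^-nonzero t τ≢0)
    Kκ : K κ
    Kκ = K-^ (τ ^ᶠ t) (toℕ m) τ^t∈K

  scalings-size-via-hyperplanes : ∀ {d c} → HasSize (λ (k : Fin t) → M (toℕ k) d) c → HasSize (Scaling d) (q₁ ℕ.* c)
  scalings-size-via-hyperplanes {d} containing = size-image power {P = λ (m , k) → ⊤ × M (toℕ k) d} {Q = Scaling d}
    (λ p p' _ _ → power-injective p p')
    (λ (m , k) (_ , d∈M) → ^-nonzero (toℕ (Fin.combine m k)) τ≢0 , Equivalence.to (M⇔scaling m k) d∈M)
    (λ y (y≢0 , d∈Wy) → let ((m , k) , y≡power) = power-surjective y y≢0 in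
       (m , k) , (tt , Equivalence.from (M⇔scaling m k) (subst (λ z → Σ F λ w → W w × d ≡ w * z) y≡power d∈Wy)) , y≡power)
    (size-× (size-Fin q₁) containing)

  -- The nonzero y with d ∈ W y are counted once through W ∖ {0} (as y = w⁻¹ d) and once through
  -- the hyperplanes M_k ∋ d (as y = (τ^t)^m τ^k).
  hyperplanes-containing : ∀ {d} → d ≢ 0# → Σ ℕ λ c → HasSize (λ (k : Fin t) → M (toℕ k) d) c × suc (q₁ ℕ.* c) ≡ Q
  hyperplanes-containing {d} d≢0 = count (size-split (size-Fin t) (λ k → size⇒dec _≟_ (M-size (toℕ k)) d))
    where
    count : (Σ ℕ λ c → Σ ℕ λ _ → HasSize (λ k → ⊤ × M (toℕ k) d) c × _) →
            Σ ℕ λ c → HasSize (λ (k : Fin t) → M (toℕ k) d) c × suc (q₁ ℕ.* c) ≡ Q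
    count (c , _ , s , _) = c , containing ,
      trans (cong suc (size-unique (scalings-size-via-hyperplanes containing) (scalings-size-via-W d≢0))) (sym Q≡1+Q₀)
      where
      containing : HasSize (λ (k : Fin t) → M (toℕ k) d) c
      containing = size-cong (λ _ → proj₂) (λ _ m → tt , m) s

  mat-cong : ∀ {a b c d a' b' c' d'} → a ≡ a' → b ≡ b' → c ≡ c' → d ≡ d' → mat a b c d ≡ mat a' b' c' d'
  mat-cong refl refl refl refl = refl

  L : F → F → Mat2
  L a e = mat 1# 0# a e

  L-injective : ∀ {a e a' e'} → L a e ≡ L a' e' → a ≡ a' × e ≡ e'
  L-injective refl = refl , refl

  L-· : ∀ a e b e' → L a e · L b e' ≡ L (a + e * b) (e * e')
  L-· a e b e' = mat-cong
    (trans (cong₂ _+_ (*-identityˡ 1#) (zeroˡ b)) (+-identityʳ 1#))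
    (trans (cong₂ _+_ (zeroʳ 1#) (zeroˡ e')) (+-identityʳ 0#))
    (cong (_+ e * b) (*-identityʳ a))
    (trans (cong (_+ e * e') (zeroʳ a)) (+-identityˡ _))

  inv-L : ∀ c {e} → e ≢ 0# → inv (L c e) ≡ L (- (e ⁻¹ * c)) (e ⁻¹)
  inv-L c {e} e≢0 = begin
    inv (L c e)                                               ≡⟨⟩
    mat (δ * e) (δ * - 0#) (δ * - c) (δ * 1#)                 ≡⟨ mat-cong (cong (_* e) δ≡e⁻¹) (trans (cong (δ *_) -0#≈0#) (zeroʳ δ))
                                                                          (cong (_* - c) δ≡e⁻¹) (cong (_* 1#) δ≡e⁻¹) ⟩
    mat (e ⁻¹ * e) 0# (e ⁻¹ * - c) (e ⁻¹ * 1#)                ≡⟨ mat-cong (⁻¹-inverseˡ e e≢0) refl (sym (-‿distribʳ-* _ c)) (*-identityʳ _) ⟩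
    L (- (e ⁻¹ * c)) (e ⁻¹)                                   ∎
    where
    δ = det (L c e) ⁻¹
    δ≡e⁻¹ : δ ≡ e ⁻¹
    δ≡e⁻¹ = cong _⁻¹ (trans (cong₂ _+_ (*-identityˡ e) (trans (cong -_ (zeroˡ c)) -0#≈0#)) (+-identityʳ e))

  f^≡L : ∀ j → mpow (fmat θ) j ≡ L 0# (θ ^ᶠ j)
  f^≡L zero    = refl
  f^≡L (suc j) = trans (cong (fmat θ ·_) (f^≡L j))
    (trans (L-· 0# θ 0# (θ ^ᶠ j)) (cong (λ a → L a (θ * θ ^ᶠ j)) (trans (+-identityˡ _) (zeroʳ θ))))

  n·f^≡L : ∀ α j → nmat α · mpow (fmat θ) j ≡ L α (θ ^ᶠ j)
  n·f^≡L α j = trans (cong (nmat α ·_) (f^≡L j))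
    (trans (L-· α 1# 0# (θ ^ᶠ j)) (cong₂ L (trans (cong (α +_) (zeroʳ 1#)) (+-identityʳ α)) (*-identityˡ _)))

  f^·n≡L : ∀ i α → mpow (fmat θ) i · nmat α ≡ L (θ ^ᶠ i * α) (θ ^ᶠ i)
  f^·n≡L i α = trans (cong (_· nmat α) (f^≡L i)) (trans (L-· 0# (θ ^ᶠ i) α 1#) (cong₂ L (+-identityˡ _) (*-identityʳ _)))

  vertex : F × Fin t → Mat2
  vertex (c , j) = L c (θ^ j)

  vertex-injective : ∀ p p' → vertex p ≡ vertex p' → p ≡ p'
  vertex-injective (c , j) (c' , j') Lcθʲ≡Lc'θʲ' =
    let (c≡c' , θʲ≡θʲ') = L-injective Lcθʲ≡Lc'θʲ' in cong₂ _,_ c≡c' (θ^-injective {j} {j'} θʲ≡θʲ')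

  vertex∈G : ∀ p → InG θ (vertex p)
  vertex∈G (c , j) = c , toℕ j , sym (n·f^≡L c (toℕ j))

  opaque
    G⇒vertex : ∀ A → InG θ A → Σ (F × Fin t) λ p → A ≡ vertex p
    G⇒vertex A (α , j , A≡) = (α , fromℕ< j%t<t) , trans A≡ (trans (n·f^≡L α j)
      (cong (L α) (trans (θ-order.^-% j) (cong (θ ^ᶠ_) (sym (FinP.toℕ-fromℕ< j%t<t))))))
      where j%t<t : j ℕ.% t < t
            j%t<t = m%n<n j t

  G-size : HasSize (InG θ) (q ^ r ℕ.* t)
  G-size = size-image vertex (λ p p' _ _ → vertex-injective p p') (λ p _ → vertex∈G p)
    (λ A A∈G → let (p , A≡) = G⇒vertex A A∈G in p , (tt , tt) , A≡) (size-× sizeF (size-Fin t))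

  class : Mat2 → Fin t
  class A = θ-log (Mat2.a₂₂ A)

  class-vertex : ∀ p → class (vertex p) ≡ proj₂ p
  class-vertex (c , j) = θ-log-θ^ j

  class-size : ∀ j → HasSize (λ z → InG θ z × class z ≡ j) (q ^ r)
  class-size j = size-image (λ α → vertex (α , j)) (λ α β _ _ eq → cong proj₁ (vertex-injective (α , j) (β , j) eq))
    (λ α _ → vertex∈G (α , j) , class-vertex (α , j))
    (λ A (A∈G , classA≡j) → let ((α , i) , A≡) = G⇒vertex A A∈G in
       α , tt , trans A≡ (cong (λ i → vertex (α , i)) (trans (sym (class-vertex (α , i))) (trans (cong class (sym A≡)) classA≡j))))
    sizeF

  M-φ : Fin t → F → Set
  M-φ i = M (toℕ (φ ⟨$⟩ʳ i))

  M-φ-subspace : ∀ i → IsSubspace K (M-φ i)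
  M-φ-subspace i = M-subspace (toℕ (φ ⟨$⟩ʳ i))

  M-φ-size : ∀ i → HasSize (M-φ i) Q
  M-φ-size i = M-size (toℕ (φ ⟨$⟩ʳ i))

  ∈S⇔ : ∀ c i → InS W τ θ φ (L c (θ^ i)) ⇔ (¬ M-φ i ((θ^ i) ⁻¹ * c))
  ∈S⇔ c i = mk⇔ to from
    where
    to : InS W τ θ φ (L c (θ^ i)) → ¬ M-φ i ((θ^ i) ⁻¹ * c)
    to (i' , α , α∉ , L≡) m with L-injective (trans L≡ (f^·n≡L (toℕ i') α))
    ... | c≡θⁱ'α , θⁱ≡θⁱ' with θ^-injective {i} {i'} θⁱ≡θⁱ'
    ... | refl = α∉ (subst (M-φ i) (trans (cong ((θ^ i) ⁻¹ *_) c≡θⁱ'α) (⁻¹*[*]-cancel α (θ^-nonzero i))) m)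
    from : ¬ M-φ i ((θ^ i) ⁻¹ * c) → InS W τ θ φ (L c (θ^ i))
    from m∉ = i , (θ^ i) ⁻¹ * c , m∉ , sym (trans (f^·n≡L (toℕ i) _) (cong (λ a → L a (θ^ i)) (*[⁻¹*]-cancel c (θ^-nonzero i))))

  S⊆G : ∀ A → InS W τ θ φ A → InG θ A
  S⊆G A (i , α , _ , A≡) = θ ^ᶠ toℕ i * α , toℕ i , trans A≡ (trans (f^·n≡L (toℕ i) α) (sym (n·f^≡L _ (toℕ i))))

  I∉S : ¬ InS W τ θ φ I₂
  I∉S I∈S = Equivalence.to (∈S⇔ 0# 0F) (subst (InS W τ θ φ) I≡L I∈S) (subst (M-φ 0F) (sym (zeroʳ _)) (Subspace.0∈ (M-subspace (toℕ (φ ⟨$⟩ʳ 0F)))))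
    where
    0F : Fin t
    0F = fromℕ< (ℕ.>-nonZero⁻¹ t)
    I≡L : I₂ ≡ L 0# (θ^ 0F)
    I≡L = cong (L 0#) (cong (θ ^ᶠ_) (sym (FinP.toℕ-fromℕ< (ℕ.>-nonZero⁻¹ t))))

  θ^-⁻¹ : ∀ i → (θ^ i) ⁻¹ ≡ θ^ (negF i)
  θ^-⁻¹ i = ⁻¹-unique (θ^-nonzero i) (trans (*-comm _ _) (θ^-negF i))

  M-neg : ∀ k {x} → M k (- x) → M k x
  M-neg k {x} m = subst (M k) (-‿involutive x) (Subspace.neg-closed (M-subspace k) _ m)

  S-inverse-closed : ∀ A → InS W τ θ φ A → InS W τ θ φ (inv A)
  S-inverse-closed A (i , α , α∉ , A≡) = subst (InS W τ θ φ) (sym inv-A≡) (Equivalence.from (∈S⇔ (- α) (negF i)) -α∉)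
    where
    inv-A≡ : inv A ≡ L (- α) (θ^ (negF i))
    inv-A≡ = begin
      inv A                                         ≡⟨ cong inv (trans A≡ (f^·n≡L (toℕ i) α)) ⟩
      inv (L (θ^ i * α) (θ^ i))                     ≡⟨ inv-L _ (θ^-nonzero i) ⟩
      L (- ((θ^ i) ⁻¹ * (θ^ i * α))) ((θ^ i) ⁻¹)    ≡⟨ cong₂ (λ a e → L (- a) e) (⁻¹*[*]-cancel α (θ^-nonzero i)) (θ^-⁻¹ i) ⟩
      L (- α) (θ^ (negF i))                         ∎
    -α∉ : ¬ M-φ (negF i) ((θ^ (negF i)) ⁻¹ * - α)
    -α∉ m with Equivalence.from (symmetric i _) m
    ... | α' , α'∈ , θ^negF⁻¹-α≡α'θⁱ = α∉ (M-neg (toℕ (φ ⟨$⟩ʳ i)) (subst (M-φ i) α'≡-α α'∈))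
      where
      α'≡-α : α' ≡ - α
      α'≡-α = *-cancelʳ (θ^-nonzero i) (begin
        α' * θ^ i                       ≡⟨ sym θ^negF⁻¹-α≡α'θⁱ ⟩
        (θ^ (negF i)) ⁻¹ * - α          ≡⟨ cong (_* - α) (⁻¹-unique (θ^-nonzero (negF i)) (θ^-negF i)) ⟩
        θ^ i * - α                      ≡⟨ *-comm _ _ ⟩
        - α * θ^ i                      ∎)

  Adjacent : Mat2 → Mat2 → Set
  Adjacent = CayAdj W τ θ φ

  shift : F → Fin t → Fin t → F
  shift a u j = (θ^ (u ⊖ j)) ⁻¹ * a

  Forbidden : F → Fin t → F × Fin t → Set
  Forbidden a u (c , j) = M-φ (u ⊖ j) (c - shift a u j)

  vertex·vertex⁻¹ : ∀ a u c j → vertex (a , u) · inv (vertex (c , j)) ≡ L (a - θ^ (u ⊖ j) * c) (θ^ (u ⊖ j))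
  vertex·vertex⁻¹ a u c j = begin
    L a θᵘ · inv (L c θʲ)                         ≡⟨ cong (L a θᵘ ·_) (inv-L c (θ^-nonzero j)) ⟩
    L a θᵘ · L (- (θʲ ⁻¹ * c)) (θʲ ⁻¹)            ≡⟨ L-· a θᵘ _ _ ⟩
    L (a + θᵘ * - (θʲ ⁻¹ * c)) (θᵘ * θʲ ⁻¹)       ≡⟨ cong₂ L (solve 4 (λ a U V c → a :+ U :* (:- (V :* c)) := a :- U :* V :* c) refl a θᵘ (θʲ ⁻¹) c) refl ⟩
    L (a - θᵘ * θʲ ⁻¹ * c) (θᵘ * θʲ ⁻¹)           ≡⟨ cong (λ e → L (a - e * c) e) θᵘθʲ⁻¹≡ ⟩
    L (a - θ^ (u ⊖ j) * c) (θ^ (u ⊖ j))           ∎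
    where
    θᵘ = θ^ u
    θʲ = θ^ j
    θᵘθʲ⁻¹≡ : θᵘ * θʲ ⁻¹ ≡ θ^ (u ⊖ j)
    θᵘθʲ⁻¹≡ = begin
      θᵘ * θʲ ⁻¹                       ≡⟨ cong (_* θʲ ⁻¹) (sym (θ^-⊖ u j)) ⟩
      θ^ (u ⊖ j) * θʲ * θʲ ⁻¹          ≡⟨ *-assoc _ _ _ ⟩
      θ^ (u ⊖ j) * (θʲ * θʲ ⁻¹)        ≡⟨ cong (θ^ (u ⊖ j) *_) (⁻¹-inverse θʲ (θ^-nonzero j)) ⟩
      θ^ (u ⊖ j) * 1#                  ≡⟨ *-identityʳ _ ⟩
      θ^ (u ⊖ j)                       ∎

  adjacent⇔ : ∀ a u c j → Adjacent (vertex (a , u)) (vertex (c , j)) ⇔ (¬ Forbidden a u (c , j))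
  adjacent⇔ a u c j = mk⇔
    (λ adj f → Equivalence.to (∈S⇔ _ i) (subst (InS W τ θ φ) (vertex·vertex⁻¹ a u c j) adj)
                 (subst (M-φ i) (sym rewritten) (Subspace.neg-closed (M-subspace (toℕ (φ ⟨$⟩ʳ i))) _ f)))
    (λ ¬f → subst (InS W τ θ φ) (sym (vertex·vertex⁻¹ a u c j))
              (Equivalence.from (∈S⇔ _ i) (λ m → ¬f (M-neg (toℕ (φ ⟨$⟩ʳ i)) (subst (M-φ i) rewritten m)))))
    where
    i = u ⊖ j
    rewritten : (θ^ i) ⁻¹ * (a - θ^ i * c) ≡ - (c - shift a u j)
    rewritten = begin
      (θ^ i) ⁻¹ * (a - θ^ i * c)                ≡⟨ solve 4 (λ V a U c → V :* (a :- U :* c) := :- (V :* U :* c :- V :* a)) refl ((θ^ i) ⁻¹) a (θ^ i) c ⟩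
      - ((θ^ i) ⁻¹ * θ^ i * c - shift a u j)    ≡⟨ cong (λ x → - (x * c - shift a u j)) (⁻¹-inverseˡ (θ^ i) (θ^-nonzero i)) ⟩
      - (1# * c - shift a u j)                  ≡⟨ cong (λ x → - (x - shift a u j)) (*-identityˡ c) ⟩
      - (c - shift a u j)                       ∎

  infix 4 _≟ₚ_
  _≟ₚ_ : (p p' : F × Fin t) → Dec (p ≡ p')
  _≟ₚ_ = ≡-dec _≟_ Fin._≟_

  pairs-size : HasSize (λ (_ : F × Fin t) → ⊤) (q ^ r ℕ.* t)
  pairs-size = size-cong (λ _ _ → tt) (λ _ _ → tt , tt) (size-× sizeF (size-Fin t))

  Forbidden-size : ∀ a u → HasSize (Forbidden a u) (t ℕ.* Q)
  Forbidden-size a u = size-cong (λ _ → proj₂) (λ _ f → tt , f)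
    (size-Σ (size-Fin t) (λ j _ → translate-size (M-size (toℕ (φ ⟨$⟩ʳ (u ⊖ j)))) (shift a u j)))

  neighbourhood-size : ∀ {a u n} → HasSize (λ p → ⊤ × ¬ Forbidden a u p) n →
    HasSize (λ z → InG θ z × Adjacent (vertex (a , u)) z) n
  neighbourhood-size {a} {u} = size-image vertex (λ p p' _ _ → vertex-injective p p')
    (λ (c , j) (_ , ¬f) → vertex∈G (c , j) , Equivalence.from (adjacent⇔ a u c j) ¬f)
    (λ z (z∈G , adj) → let ((c , j) , z≡) = G⇒vertex z z∈G in
       (c , j) , (tt , Equivalence.to (adjacent⇔ a u c j) (subst (Adjacent _) z≡ adj)) , z≡)

  common-neighbourhood-size : ∀ {a u b v n} → HasSize (λ p → ¬ Forbidden a u p × ¬ Forbidden b v p) n →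
    HasSize (λ z → InG θ z × Adjacent (vertex (a , u)) z × Adjacent (vertex (b , v)) z) n
  common-neighbourhood-size {a} {u} {b} {v} = size-image vertex (λ p p' _ _ → vertex-injective p p')
    (λ (c , j) (¬f , ¬f') → vertex∈G (c , j) , Equivalence.from (adjacent⇔ a u c j) ¬f , Equivalence.from (adjacent⇔ b v c j) ¬f')
    (λ z (z∈G , adj , adj') → let ((c , j) , z≡) = G⇒vertex z z∈G in
       (c , j) , (Equivalence.to (adjacent⇔ a u c j) (subst (Adjacent _) z≡ adj) ,
                  Equivalence.to (adjacent⇔ b v c j) (subst (Adjacent _) z≡ adj')) , z≡)

  q^r≡[1+q₁]*Q : q ^ r ≡ suc q₁ ℕ.* Q
  q^r≡[1+q₁]*Q = trans q^r≡q*Q (cong (ℕ._* Q) q≡1+q₁)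

  degree-value : ∀ {n} → n ℕ.+ t ℕ.* Q ≡ q ^ r ℕ.* t → n ≡ Q ℕ.* N
  degree-value {n} n+tQ≡q^r*t =
    trans (degree-arithmetic {n} {t} {q₁} {Q} (trans n+tQ≡q^r*t (cong (ℕ._* t) q^r≡[1+q₁]*Q))) (cong (Q ℕ.*_) (sym N≡t*q₁))

  vertex-degree : ∀ a u → HasSize (λ z → InG θ z × Adjacent (vertex (a , u)) z) (Q ℕ.* N)
  vertex-degree a u =
    let (n , non-forbidden , n+tQ≡q^r*t) =
          size-∖ _≟ₚ_ {A = Forbidden a u} pairs-size (size-cong (λ _ f → tt , f) (λ _ → proj₂) (Forbidden-size a u))
    in subst (HasSize _) (degree-value n+tQ≡q^r*t) (neighbourhood-size non-forbidden)

  φ-injective : ∀ {i j} → φ ⟨$⟩ʳ i ≡ φ ⟨$⟩ʳ j → i ≡ j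
  φ-injective φi≡φj = trans (sym (inverseˡ φ)) (trans (cong (φ ⟨$⟩ˡ_) φi≡φj) (inverseˡ φ))

  distinct-cosets-meet-size : ∀ {i i'} → i ≢ i' → ∀ e e' → HasSize (λ c → M-φ i (c - e) × M-φ i' (c - e')) X
  distinct-cosets-meet-size {i} {i'} i≢i' e e' = meet
    (⊈⇒witness _≟_ (M-φ-size i') (size⇒dec _≟_ (M-φ-size i))
      (M-distinct (FinP.toℕ<n (φ ⟨$⟩ʳ i)) (FinP.toℕ<n (φ ⟨$⟩ʳ i')) (λ k≡k' → i≢i' (φ-injective (FinP.toℕ-injective k≡k')))))
    where
    meet : (Σ F λ x → M-φ i' x × ¬ M-φ i x) → HasSize (λ c → M-φ i (c - e) × M-φ i' (c - e')) X
    meet (x , x∈M' , x∉M) = Hyperplanes.coset-intersection-size (trans q^r≡q*Q (ℕP.*-comm q Q))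
      (M-φ-subspace i) (M-φ-subspace i') (M-φ-size i) (M-φ-size i') x∈M' x∉M X*q≡Q e e'

  λ₂-value : ∀ {n} → n ℕ.+ t ℕ.* Q ℕ.+ t ℕ.* Q ≡ q ^ r ℕ.* t ℕ.+ t ℕ.* X → n ≡ X ℕ.* q₁ ℕ.* N
  λ₂-value {n} n+tQ+tQ≡q^r*t+tX = trans (λ₂-arithmetic {n} {t} {q₁} {X} (begin
    n ℕ.+ t ℕ.* (X ℕ.* suc q₁) ℕ.+ t ℕ.* (X ℕ.* suc q₁) ≡⟨ cong (λ y → n ℕ.+ t ℕ.* y ℕ.+ t ℕ.* y) (sym Q≡X*[1+q₁]) ⟩
    n ℕ.+ t ℕ.* Q ℕ.+ t ℕ.* Q                           ≡⟨ n+tQ+tQ≡q^r*t+tX ⟩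
    q ^ r ℕ.* t ℕ.+ t ℕ.* X                             ≡⟨ cong (λ y → y ℕ.* t ℕ.+ t ℕ.* X) (trans q^r≡[1+q₁]*Q (cong (suc q₁ ℕ.*_) Q≡X*[1+q₁])) ⟩
    suc q₁ ℕ.* (X ℕ.* suc q₁) ℕ.* t ℕ.+ t ℕ.* X         ∎)) (cong (X ℕ.* q₁ ℕ.*_) (sym N≡t*q₁))
    where
    Q≡X*[1+q₁] : Q ≡ X ℕ.* suc q₁
    Q≡X*[1+q₁] = trans (sym X*q≡Q) (cong (X ℕ.*_) q≡1+q₁)

  λ₂-count : ∀ a u b v → u ≢ v →
    HasSize (λ z → InG θ z × Adjacent (vertex (a , u)) z × Adjacent (vertex (b , v)) z) (X ℕ.* q₁ ℕ.* N)
  λ₂-count a u b v u≢v =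
    let (n , s , n+tQ+tQ≡q^r*t+tX) = inclusion–exclusion _≟ₚ_ {A = Forbidden a u} {B = Forbidden b v} pairs-size
                                       (Forbidden-size a u) (Forbidden-size b v) both-forbidden
    in subst (HasSize _) (λ₂-value n+tQ+tQ≡q^r*t+tX) (common-neighbourhood-size s)
    where
    both-forbidden : HasSize (λ p → Forbidden a u p × Forbidden b v p) (t ℕ.* X)
    both-forbidden = size-cong (λ _ → proj₂) (λ _ f → tt , f) (size-Σ (size-Fin t)
      (λ j _ → distinct-cosets-meet-size (λ u⊖j≡v⊖j → u≢v (⊖-injectiveˡ j u⊖j≡v⊖j)) (shift a u j) (shift b v j)))

  q₁*Q≡1+a₀ : q₁ ℕ.* Q ≡ suc (q ^ r ∸ Q ∸ 1)
  q₁*Q≡1+a₀ = begin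
    q₁ ℕ.* Q                   ≡⟨ sym (ℕP.m+[n∸m]≡n 1≤q₁*Q) ⟩
    suc (q₁ ℕ.* Q ∸ 1)         ≡⟨ cong (λ m → suc (m ∸ 1)) (sym (trans (cong (_∸ Q) q^r≡[1+q₁]*Q) (ℕP.m+n∸m≡n Q (q₁ ℕ.* Q)))) ⟩
    suc (q ^ r ∸ Q ∸ 1)        ∎
    where
    1≤q₁*Q : 1 ≤ q₁ ℕ.* Q
    1≤q₁*Q = ℕ.>-nonZero⁻¹ (q₁ ℕ.* Q) ⦃ ℕP.m*n≢0 q₁ Q ⦃ q₁-nonZero ⦄ ⦃ subst NonZero (sym Q≡1+Q₀) _ ⦄ ⦄

  t*q₁≡1+a₀+Q₀ : t ℕ.* q₁ ≡ suc (q ^ r ∸ Q ∸ 1) ℕ.+ Q₀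
  t*q₁≡1+a₀+Q₀ = ℕP.suc-injective (begin
    suc (t ℕ.* q₁)                       ≡⟨ cong suc (sym N≡t*q₁) ⟩
    suc N                                ≡⟨ sym q^r≡1+N ⟩
    q ^ r                                ≡⟨ q^r≡[1+q₁]*Q ⟩
    Q ℕ.+ q₁ ℕ.* Q                       ≡⟨ cong₂ ℕ._+_ Q≡1+Q₀ q₁*Q≡1+a₀ ⟩
    suc Q₀ ℕ.+ suc (q ^ r ∸ Q ∸ 1)       ≡⟨ cong suc (ℕP.+-comm Q₀ _) ⟩
    suc (suc (q ^ r ∸ Q ∸ 1) ℕ.+ Q₀)     ∎)

  λ₁-value : ∀ {n c} → suc (q₁ ℕ.* c) ≡ Q → n ℕ.+ t ℕ.* Q ℕ.+ t ℕ.* Q ≡ q ^ r ℕ.* t ℕ.+ c ℕ.* Q →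
    n ≡ Q ℕ.* (q ^ r ∸ Q ∸ 1)
  λ₁-value {n} {c} 1+q₁c≡Q n+tQ+tQ≡q^r*t+cQ = trans
    (λ₁-arithmetic {n} {t} {c} {q₁} {Q₀} {q ^ r ∸ Q ∸ 1}
      (ℕP.suc-injective (trans 1+q₁c≡Q Q≡1+Q₀)) (subst (λ m → q₁ ℕ.* m ≡ suc (q ^ r ∸ Q ∸ 1)) Q≡1+Q₀ q₁*Q≡1+a₀) t*q₁≡1+a₀+Q₀
      (begin
        n ℕ.+ t ℕ.* suc Q₀ ℕ.+ t ℕ.* suc Q₀      ≡⟨ cong (λ m → n ℕ.+ t ℕ.* m ℕ.+ t ℕ.* m) (sym Q≡1+Q₀) ⟩
        n ℕ.+ t ℕ.* Q ℕ.+ t ℕ.* Q                 ≡⟨ n+tQ+tQ≡q^r*t+cQ ⟩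
        q ^ r ℕ.* t ℕ.+ c ℕ.* Q                   ≡⟨ cong₂ (λ m m' → m ℕ.* t ℕ.+ c ℕ.* m') (trans q^r≡[1+q₁]*Q (cong (suc q₁ ℕ.*_) Q≡1+Q₀)) Q≡1+Q₀ ⟩
        suc q₁ ℕ.* suc Q₀ ℕ.* t ℕ.+ c ℕ.* suc Q₀  ∎))
    (cong (ℕ._* (q ^ r ∸ Q ∸ 1)) (sym Q≡1+Q₀))

  module _ (a b : F) (u : Fin t) where
    SameCoset : Fin t → Set
    SameCoset j = M-φ (u ⊖ j) (shift a u j - shift b u j)

    partner : Fin t → Fin t
    partner j = φ ⟨$⟩ʳ negF (u ⊖ j)

    partner-injective : ∀ i j → partner i ≡ partner j → i ≡ j
    partner-injective i j partner≡ =
      ⊖-injectiveʳ u (trans (sym (negF-involutive _)) (trans (cong negF (φ-injective partner≡)) (negF-involutive _)))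

    same-coset⇔ : ∀ j → SameCoset j ⇔ M (toℕ (partner j)) (a - b)
    same-coset⇔ j = mk⇔
      (λ m → Equivalence.to (symmetric i (a - b)) (V * (a - b) , subst (M-φ i) difference m ,
                sym (trans (*-comm _ _) (*[⁻¹*]-cancel (a - b) (θ^-nonzero i)))))
      (λ m → let (α , α∈ , a-b≡αθⁱ) = Equivalence.from (symmetric i (a - b)) m in
         subst (M-φ i) (sym (trans difference (trans (cong (V *_) (trans a-b≡αθⁱ (*-comm _ _))) (⁻¹*[*]-cancel α (θ^-nonzero i))))) α∈)
      where
      i = u ⊖ j
      V = (θ^ i) ⁻¹
      difference : shift a u j - shift b u j ≡ V * (a - b)
      difference = solve 3 (λ V a b → V :* a :- V :* b := V :* (a :- b)) refl V a b

    same-coset-size : ∀ {c} → HasSize (λ k → M (toℕ k) (a - b)) c → HasSize SameCoset c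
    same-coset-size {c} containing = count (size-split (size-Fin t) (λ j → size⇒dec _≟_ (M-φ-size (u ⊖ j)) (shift a u j - shift b u j)))
      where
      count : (Σ ℕ λ c' → Σ ℕ λ _ → HasSize (λ j → ⊤ × SameCoset j) c' × _) → HasSize SameCoset c
      count (c' , _ , s , _) = subst (HasSize SameCoset) (size-unique image containing) same
        where
        same : HasSize SameCoset c'
        same = size-cong (λ _ → proj₂) (λ _ m → tt , m) s
        image : HasSize (λ k → M (toℕ k) (a - b)) c'
        image = size-image partner (λ i j _ _ → partner-injective i j) (λ j m → Equivalence.to (same-coset⇔ j) m)
          (λ k m → let (j , k≡partner) = injective⇒surjective partner partner-injective k in
             j , Equivalence.from (same-coset⇔ j) (subst (λ k → M (toℕ k) (a - b)) k≡partner m) , k≡partner)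
          same

    both-forbidden-size : ∀ {c} → HasSize SameCoset c → HasSize (λ p → Forbidden a u p × Forbidden b u p) (c ℕ.* Q)
    both-forbidden-size same = size-cong (λ (x , j) (same , f) → f , cosets-equal (M-φ-subspace (u ⊖ j)) same x f)
                                         (λ (x , j) (f , f') → cosets-meet (M-φ-subspace (u ⊖ j)) x f f' , f)
      (size-Σ same (λ j _ → translate-size (M-φ-size (u ⊖ j)) (shift a u j)))

  λ₁-count : ∀ a b u → a ≢ b →
    HasSize (λ z → InG θ z × Adjacent (vertex (a , u)) z × Adjacent (vertex (b , u)) z) (Q ℕ.* (q ^ r ∸ Q ∸ 1))
  λ₁-count a b u a≢b = count (hyperplanes-containing (λ a-b≡0 → a≢b (x-y≡0⇒x≡y a-b≡0)))
    where
    count : (Σ ℕ λ c → HasSize (λ k → M (toℕ k) (a - b)) c × suc (q₁ ℕ.* c) ≡ Q) →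
            HasSize (λ z → InG θ z × Adjacent (vertex (a , u)) z × Adjacent (vertex (b , u)) z) (Q ℕ.* (q ^ r ∸ Q ∸ 1))
    count (c , containing , 1+q₁c≡Q) =
      let (n , s , n+tQ+tQ≡q^r*t+cQ) = inclusion–exclusion _≟ₚ_ {A = Forbidden a u} {B = Forbidden b u} pairs-size
                                         (Forbidden-size a u) (Forbidden-size b u) (both-forbidden-size a b u (same-coset-size a b u containing))
      in subst (HasSize _) (λ₁-value 1+q₁c≡Q n+tQ+tQ≡q^r*t+cQ) (common-neighbourhood-size s)

  common-same-class : ∀ x y → InG θ x → InG θ y → x ≢ y → class x ≡ class y →
    HasSize (λ z → InG θ z × Adjacent x z × Adjacent y z) (Q ℕ.* (q ^ r ∸ Q ∸ 1))
  common-same-class x y x∈G y∈G x≢y same with G⇒vertex x x∈G | G⇒vertex y y∈G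
  ... | (a , u) , refl | (b , v) , refl =
    subst (λ v → HasSize (λ z → InG θ z × Adjacent (vertex (a , u)) z × Adjacent (vertex (b , v)) z) _) u≡v
      (λ₁-count a b u (λ a≡b → x≢y (cong₂ (λ c j → vertex (c , j)) a≡b u≡v)))
    where
    u≡v : u ≡ v
    u≡v = trans (sym (class-vertex (a , u))) (trans same (class-vertex (b , v)))

  common-different-class : ∀ x y → InG θ x → InG θ y → class x ≢ class y →
    HasSize (λ z → InG θ z × Adjacent x z × Adjacent y z) (X ℕ.* q₁ ℕ.* N)
  common-different-class x y x∈G y∈G differ with G⇒vertex x x∈G | G⇒vertex y y∈G
  ... | (a , u) , refl | (b , v) , refl =
    λ₂-count a u b v (λ u≡v → differ (trans (class-vertex (a , u)) (trans u≡v (sym (class-vertex (b , v))))))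

  degree : ∀ x → InG θ x → HasSize (λ z → InG θ z × Adjacent x z) (Q ℕ.* N)
  degree x x∈G with G⇒vertex x x∈G
  ... | (a , u) , refl = vertex-degree a u

theorem2 :
    (𝔽 : Field) → let open FieldTheory 𝔽 in
    (q r t : ℕ) → IsPrimePower q → 1 < r →
    HasSize (λ (_ : F) → ⊤) (q ^ r) →
    (K : F → Set) → IsSubfield K → HasSize K q →
    (τ : F) → IsPrimitive τ →
    (θ : F) → θ ≡ τ ^ᶠ (q ∸ 1) →
    t ℕ.* (q ∸ 1) ≡ q ^ r ∸ 1 →
    (W : F → Set) → IsSubspace K W → HasDim K W (r ∸ 1) →
    (φ : Permutation′ t) →
    (∀ (i : Fin t) (β : F) →
       (Σ F λ α → ψM W τ (toℕ (φ ⟨$⟩ʳ i)) α × β ≡ α * (θ ^ᶠ toℕ i))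
       ⇔ ψM W τ (toℕ (φ ⟨$⟩ʳ negF i)) β) →
    (∀ A → InS W τ θ φ A → InG θ A) ×
    ¬ InS W τ θ φ I₂ ×
    (∀ A → InS W τ θ φ A → InS W τ θ φ (inv A)) ×
    IsDDG (InG θ) (CayAdj W τ θ φ)
      (q ^ r ℕ.* t)
      (q ^ (r ∸ 1) ℕ.* (q ^ r ∸ 1))
      (q ^ (r ∸ 1) ℕ.* (q ^ r ∸ q ^ (r ∸ 1) ∸ 1))
      (q ^ (r ∸ 2) ℕ.* (q ∸ 1) ℕ.* (q ^ r ∸ 1))
      t
      (q ^ r)
theorem2 𝔽 q r t prime-power 1<r sizeF K subfield sizeK τ τ-primitive θ θ≡τ^[q-1] t*[q-1]≡q^r-1 W subspaceW dimW φ symmetric =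
  S⊆G , I∉S , S-inverse-closed ,
  G-size , degree , class , class-size , common-same-class , common-different-class
  where
  open import Data.Product using (_,_)
  open Construction 𝔽 q r t prime-power 1<r sizeF K subfield sizeK τ τ-primitive θ θ≡τ^[q-1] t*[q-1]≡q^r-1
                    W subspaceW dimW φ symmetric
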